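{- Let $n\geq 3$ and $2\leq k\leq\binom{n}{2}$, and let $p,q,r$ be the integers with $k\binom{p}{2}\leq\binom{n}{2}<k\binom{p+1}{2}$, $\binom{n}{2}=k\binom{p}{2}+qp+r$, $0\leq q<k$, $0\leq r<p$. Suppose $M(k,n)$ is attained by a packing of Type 1 or Type 2, where in the case of Type 2 with $r\geq(p-1)/2$ the non-complete member $G\in\mathcal{F}_{p,r}$ of the packing satisfies $\omega(G)=p$. Then $$\omega(k,n)=\chi(k,n)=\mathrm{ch}(k,n)=\mathrm{col}(k,n)=\lfloor M(k,n)\rfloor+k$$ and $$\kappa^*(k,n)=\lambda^*(k,n)=\delta^*(k,n)=\lfloor M(k,n)\rfloor.$$
   Context: For a finite graph $G$, $\mathrm{Mad}(G)=\max\{2e(H)/|V(H)| : H\subseteq G,\ |V(H)|\geq 1\}$. For a graph parameter $\mathfrak{p}$, $\mathfrak{p}(k,n)$ is the maximum of $\sum_{i=1}^k\mathfrak{p}(G_i)$ over all partitions of $E(K_n)$ into $k$ spanning subgraphs $G_1,\dots,G_k$; $M(k,n)$ is this for $\mathfrak{p}=\mathrm{Mad}$. Parameters: $\omega$ clique number; $\chi$ chromatic number; $\mathrm{ch}$ choice (list chromatic) number; $\delta^*(G)$ degeneracy, i.e. $\max\delta(H)$ over induced subgraphs $H$; $\mathrm{col}(G)=\delta^*(G)+1$; $\kappa^*(G)$ (resp. $\lambda^*(G)$) the maximum vertex (resp. edge) connectivity of an induced subgraph of $G$. For $0<r<p$ and $m=\binom{p}{2}+r$, $\mathcal{F}_{p,r}$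 is: the graphs with $m$ edges containing $K_p$, if $r<(p-1)/2$; the graphs with $m$ edges containing $K_p$ or having exactly $p+1$ vertices, if $r=(p-1)/2$; the graphs with $m$ edges and exactly $p+1$ vertices, if $r>(p-1)/2$. "$M(k,n)$ is attained by a packing of Type 1" means ($r=0$ and) $K_n$ has an edge decomposition, ignoring isolated vertices, into $q$ copies of $K_{p+1}$ and $k-q$ copies of $K_p$, whose $\mathrm{Mad}$ values sum to $M(k,n)$; "Type 2" means ($0<r<p$ and) $K_n$ has an edge decomposition into $q$ copies of $K_{p+1}$, $k-q-1$ copies of $K_p$ and one graph $G\in\mathcal{F}_{p,r}$, whose $\mathrm{Mad}$ values sum to $M(k,n)$. -}

module Defs where

open import Data.Bool using (Bool; true; false; not; _∧_; if_then_else_)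
open import Data.Nat using (ℕ; zero; suc; _+_; _*_; _≤_; _<_; _<ᵇ_; NonZero)
open import Data.Nat.Combinatorics using (_C_)
open import Data.Integer using (ℤ; +_)
open import Data.Rational as ℚ using (ℚ; 0ℚ)
open import Data.Fin using (Fin; toℕ) renaming (zero to fzero; suc to fsuc)
open import Data.Fin.Subset using (Subset; _∈_; _∉_; _⊆_; _∩_; ∁; ∣_∣; Nonempty)
open import Data.Vec using (tabulate)
open import Data.List using (List; allFin; map)
open import Data.Nat.ListAction using (sum)
open import Data.Bool.ListAction using (any)
open import Data.Product using (Σ; ∃; ∃-syntax; _×_; _,_)
open import Data.Sum using (_⊎_)
open import Relation.Nullary using (¬_)
open import Relation.Nullary.Decidable using (⌊_⌋)
open import Relation.Binary.PropositionalEquality using (_≡_; _≢_)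
open import Function.Definitions using (Injective)
import Data.Fin as F

-- Graphs on the vertex set Fin n, given by a Boolean adjacency matrix.
-- (All graphs to which the parameters below are applied are colour
-- classes of an edge colouring of K_n, hence simple: symmetric and
-- loopless.)

Adj : ℕ → Set
Adj n = Fin n → Fin n → Bool

ΣFin : ∀ {n} → (Fin n → ℕ) → ℕ
ΣFin {n} f = sum (map f (allFin n))

edgeCount : ∀ {n} → Adj n → ℕ
edgeCount a = ΣFin λ i → ΣFin λ j → if (toℕ i <ᵇ toℕ j) ∧ a i j then 1 else 0

nonIsolated : ∀ {n} → Adj n → Subset n
nonIsolated {n} a = tabulate λ v → any (a v) (allFin n)

-- Partitions of E(K_n) into k spanning subgraphs = edge colourings
-- of K_n with colour set Fin k (colour classes may be empty).

record Colouring (k n : ℕ) : Set where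
  field
    col : Fin n → Fin n → Fin k
    sym : ∀ u v → col u v ≡ col v u

class : ∀ {k n} → Colouring k n → Fin k → Adj n
class c i u v = not ⌊ u F.≟ v ⌋ ∧ ⌊ Colouring.col c u v F.≟ i ⌋

sumℕ : ∀ {k} → (Fin k → ℕ) → ℕ
sumℕ {zero}  f = 0
sumℕ {suc k} f = f fzero + sumℕ (λ i → f (fsuc i))

sumℚ : ∀ {k} → (Fin k → ℚ) → ℚ
sumℚ {zero}  f = 0ℚ
sumℚ {suc k} f = f fzero ℚ.+ sumℚ (λ i → f (fsuc i))

IsSubgraph : ∀ {n} → Adj n → Subset n → Adj n → Set
IsSubgraph a S h = (∀ u v → h u v ≡ h v u)
                 × (∀ u v → h u v ≡ true → (u ∈ S × v ∈ S × a u v ≡ true))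

avgDeg : (e s : ℕ) → NonZero s → ℚ
avgDeg e s nz = ℚ._/_ (+ (2 * e)) s {{nz}}

Mad : ∀ {n} → Adj n → ℚ → Set
Mad a m =
  (∃[ S ] ∃[ h ] Σ (NonZero ∣ S ∣) λ nz →
      IsSubgraph a S h × m ≡ avgDeg (edgeCount h) ∣ S ∣ nz)
  × (∀ S h (nz : NonZero ∣ S ∣) → IsSubgraph a S h →
      avgDeg (edgeCount h) ∣ S ∣ nz ℚ.≤ m)

IsClique : ∀ {n} → Adj n → Subset n → Set
IsClique a S = ∀ u v → u ∈ S → v ∈ S → u ≢ v → a u v ≡ true

CliqueNumber : ∀ {n} → Adj n → ℕ → Set
CliqueNumber a w = (∃[ S ] IsClique a S × ∣ S ∣ ≡ w)
                 × (∀ S → IsClique a S → ∣ S ∣ ≤ w)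

ContainsK : ∀ {n} → Adj n → ℕ → Set
ContainsK a p = ∃[ S ] IsClique a S × ∣ S ∣ ≡ p

IsCompletePlusIsolated : ∀ {n} → Adj n → ℕ → Set
IsCompletePlusIsolated a m =
  ∃[ S ] ∣ S ∣ ≡ m
    × (∀ u v → a u v ≡ true → (u ∈ S × v ∈ S × u ≢ v))
    × (∀ u v → u ∈ S → v ∈ S → u ≢ v → a u v ≡ true)

IsProper : ∀ {n c} → Adj n → (Fin n → Fin c) → Set
IsProper a f = ∀ u v → a u v ≡ true → f u ≢ f v

ChromaticNumber : ∀ {n} → Adj n → ℕ → Set
ChromaticNumber {n} a w = (Σ (Fin n → Fin w) λ f → IsProper a f)
                        × (∀ c (f : Fin n → Fin c) → IsProper a f → w ≤ c)

-- Choice number.  A list assignment with lists of size c is given by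
-- L v : Fin c → ℕ injective (the list of v consists of the c distinct
-- colours L v 0, …, L v (c-1)).

Choosable : ∀ {n} → Adj n → ℕ → Set
Choosable {n} a c =
  ∀ (L : Fin n → Fin c → ℕ) → (∀ v → Injective _≡_ _≡_ (L v)) →
    Σ (Fin n → Fin c) λ f → ∀ u v → a u v ≡ true → L u (f u) ≢ L v (f v)

ChoiceNumber : ∀ {n} → Adj n → ℕ → Set
ChoiceNumber a w = Choosable a w × (∀ c → Choosable a c → w ≤ c)

degIn : ∀ {n} → Adj n → Subset n → Fin n → ℕ
degIn a S v = ∣ S ∩ tabulate (a v) ∣

MinDegree : ∀ {n} → Adj n → Subset n → ℕ → Set
MinDegree a S m = (∃[ v ] v ∈ S × degIn a S v ≡ m)
                × (∀ v → v ∈ S → m ≤ degIn a S v)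

Degeneracy : ∀ {n} → Adj n → ℕ → Set
Degeneracy a d = (∃[ S ] Nonempty S × MinDegree a S d)
               × (∀ S m → Nonempty S → MinDegree a S m → m ≤ d)

ColouringNumber : ∀ {n} → Adj n → ℕ → Set
ColouringNumber a w = ∃[ d ] Degeneracy a d × w ≡ suc d

data Reach {n} (a : Adj n) (T : Subset n) : Fin n → Fin n → Set where
  here : ∀ {u} → u ∈ T → Reach a T u u
  step : ∀ {u v w} → u ∈ T → a u v ≡ true → Reach a T v w → Reach a T u w

Connected : ∀ {n} → Adj n → Subset n → Set
Connected a T = ∀ u v → u ∈ T → v ∈ T → Reach a T u v

VertexSeparates : ∀ {n} → Adj n → Subset n → Subset n → Set
VertexSeparates a S X = ∣ S ∩ ∁ X ∣ ≤ 1 ⊎ ¬ Connected a (S ∩ ∁ X)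

VertexConnectivity : ∀ {n} → Adj n → Subset n → ℕ → Set
VertexConnectivity a S m =
  (∃[ X ] X ⊆ S × VertexSeparates a S X × ∣ X ∣ ≡ m)
  × (∀ X → X ⊆ S → VertexSeparates a S X → m ≤ ∣ X ∣)

KappaStar : ∀ {n} → Adj n → ℕ → Set
KappaStar a v = (∃[ S ] Nonempty S × VertexConnectivity a S v)
              × (∀ S m → Nonempty S → VertexConnectivity a S m → m ≤ v)

IsEdgeSetIn : ∀ {n} → Adj n → Subset n → Adj n → Set
IsEdgeSetIn a S F = (∀ u v → F u v ≡ F v u)
                  × (∀ u v → F u v ≡ true → (u ∈ S × v ∈ S × a u v ≡ true))

EdgeSeparates : ∀ {n} → Adj n → Subset n → Adj n → Set
EdgeSeparates a S F = ∣ S ∣ ≤ 1 ⊎ ¬ Connected (λ u v → a u v ∧ not (F u v)) S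

EdgeConnectivity : ∀ {n} → Adj n → Subset n → ℕ → Set
EdgeConnectivity a S m =
  (∃[ F ] IsEdgeSetIn a S F × EdgeSeparates a S F × edgeCount F ≡ m)
  × (∀ F → IsEdgeSetIn a S F → EdgeSeparates a S F → m ≤ edgeCount F)

LambdaStar : ∀ {n} → Adj n → ℕ → Set
LambdaStar a v = (∃[ S ] Nonempty S × EdgeConnectivity a S v)
               × (∀ S m → Nonempty S → EdgeConnectivity a S m → m ≤ v)

-- 𝔭(k,n) = v for a graph parameter given as a value relation P.

MaxSumℕ : (∀ {n} → Adj n → ℕ → Set) → ℕ → ℕ → ℕ → Set
MaxSumℕ P k n v =
  (∃[ c ] Σ (Fin k → ℕ) λ vals →
      (∀ i → P (class {k} {n} c i) (vals i)) × sumℕ vals ≡ v)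
  × (∀ (c : Colouring k n) (vals : Fin k → ℕ) →
      (∀ i → P (class c i) (vals i)) → sumℕ vals ≤ v)

MaxMad : ℕ → ℕ → ℚ → Set
MaxMad k n M =
  (∃[ c ] Σ (Fin k → ℚ) λ vals →
      (∀ i → Mad (class {k} {n} c i) (vals i)) × sumℚ vals ≡ M)
  × (∀ (c : Colouring k n) (vals : Fin k → ℚ) →
      (∀ i → Mad (class c i) (vals i)) → sumℚ vals ℚ.≤ M)

-- The family 𝓕_{p,r}  (r < (p-1)/2  ⇔  2r+1 < p, etc.)

InF : ∀ {n} → ℕ → ℕ → Adj n → Set
InF p r a =
  edgeCount a ≡ p C 2 + r
  × ( (suc (2 * r) < p × ContainsK a p)
    ⊎ (suc (2 * r) ≡ p × (ContainsK a p ⊎ ∣ nonIsolated a ∣ ≡ suc p))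
    ⊎ (p < suc (2 * r) × ∣ nonIsolated a ∣ ≡ suc p))

MadSum : ∀ {k n} → Colouring k n → ℚ → Set
MadSum {k} c M = Σ (Fin k → ℚ) λ vals → (∀ i → Mad (class c i) (vals i)) × sumℚ vals ≡ M

Type1 : (k n p q r : ℕ) → ℚ → Set
Type1 k n p q r M =
  r ≡ 0 ×
  (∃[ c ] ∃[ T ] ∣ T ∣ ≡ q
     × (∀ i → i ∈ T → IsCompletePlusIsolated (class {k} {n} c i) (suc p))
     × (∀ i → i ∉ T → IsCompletePlusIsolated (class c i) p)
     × MadSum c M)

Type2 : (k n p q r : ℕ) → ℚ → Set
Type2 k n p q r M =
  0 < r × r < p ×
  (∃[ c ] ∃[ i₀ ] ∃[ T ] i₀ ∉ T × ∣ T ∣ ≡ q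
     × (∀ i → i ∈ T → IsCompletePlusIsolated (class {k} {n} c i) (suc p))
     × (∀ i → i ∉ T → i ≢ i₀ → IsCompletePlusIsolated (class c i) p)
     × InF p r (class c i₀)
     × (p ≤ suc (2 * r) → CliqueNumber (class c i₀) p)
     × MadSum c M)

{-# OPTIONS --safe #-}

-- A d-degenerate simple graph has ω, χ, ch, col ≤ d + 1 (greedy list colouring along a
-- degeneracy order) and κ*, λ*, δ* ≤ d (in an induced subgraph, cut off the neighbourhood,
-- resp. the star, of a vertex of minimum degree); it attains all these bounds if it also
-- contains K_{d+1}.  Every graph G is ⌊Mad G⌋-degenerate, and Σᵢ ⌊Mad Gᵢ⌋ ≤ ⌊M(k,n)⌋, which
-- gives the upper bounds.  In a packing of Type 1 or 2 the i-th class contains K_{dᵢ+1} and has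
-- Mad < dᵢ + 1; its Mad values sum to M(k,n) < Σᵢ dᵢ + 1, because only the member of 𝓕_{p,r}
-- can have non-integral Mad (and that is still below p), so Σᵢ dᵢ = ⌊M(k,n)⌋.

module Submission where

open import Defs
open import Data.Bool using (Bool; true; false; not; _∧_; _∨_; if_then_else_; T)
import Data.Bool.Properties as Boolₚ
open import Data.Nat as ℕ using (ℕ; zero; suc; _+_; _*_; _≤_; _<_; _<ᵇ_; z≤n; s≤s; NonZero)
import Data.Nat.Properties as ℕₚ
open import Data.Nat.Tactic.RingSolver using (solve-∀)
open import Data.Nat.Combinatorics using (_C_; nC1≡n; nCk+nC[k+1]≡[n+1]C[k+1])
open import Data.Fin as F using (Fin; toℕ) renaming (zero to fzero; suc to fsuc)
import Data.Fin.Properties as Finₚ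
open import Data.Fin.Subset using (Subset; _∈_; _∉_; _⊆_; _∩_; ∁; ∣_∣; Nonempty; ⁅_⁆; _-_; ⊤)
open import Data.Fin.Subset.Properties
  using (p⊆q⇒∣p∣≤∣q∣; ∣⁅x⁆∣≡1; p─⊥≡p; x∈p∧x≢y⇒x∈p-y; x∈p⇒∣p-x∣<∣p∣; x∈p∩q⁺; x∈p∩q⁻; p─q⊆p; Empty-unique; ∣⊥∣≡0; nonempty?; _∈?_; ∈⊤; ∣p∣≤n;
         x∈⁅x⁆; x∉p⇒x∈∁p; x∈∁p⇒x∉p; p∩q⊆p)
open import Data.Vec using ([]; _∷_; lookup; tabulate; here; there)
import Data.Vec.Properties as Vecₚ
import Data.List as List
open import Data.Nat.ListAction using (sum)
open import Data.Integer as ℤ using (-[1+_])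
import Data.Integer.Properties as ℤₚ
open import Data.Rational as ℚ using (ℚ; mkℚ; floor)
import Data.Rational.Properties as ℚₚ
open import Data.Rational.Unnormalised as ℚᵘ using (mkℚᵘ)
import Data.Rational.Unnormalised.Properties as ℚᵘₚ
import Data.Nat.DivMod as ℕ
open import Data.Product using (Σ; ∃; ∃-syntax; _×_; _,_; proj₁; proj₂)
open import Data.Sum using (_⊎_; inj₁; inj₂; [_,_]′)
open import Data.Empty using (⊥; ⊥-elim)
open import Relation.Nullary using (¬_; ¬?; Dec; yes; no; _×-dec_)
open import Relation.Nullary.Decidable using (isYes; dec-true; dec-false; isYes≗does; ⌊⌋-map′)
open import Relation.Binary.PropositionalEquality
open import Function using (_∘_; id)
open import Function.Definitions using (Injective)
open import Data.Vec.Functional using (updateAt)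
open import Data.Vec.Functional.Properties using (updateAt-updates; updateAt-minimal)

true≢false : true ≢ false
true≢false ()

∧-true : ∀ {b c} → (b ∧ c) ≡ true → b ≡ true × c ≡ true
∧-true {true} c≡true = refl , c≡true

∨-true : ∀ {b c} → (b ∨ c) ≡ true → b ≡ true ⊎ c ≡ true
∨-true {true}  _      = inj₁ refl
∨-true {false} c≡true = inj₂ c≡true

𝟙 : Bool → ℕ
𝟙 b = if b then 1 else 0

𝟙≤1 : ∀ b → 𝟙 b ≤ 1
𝟙≤1 true  = s≤s z≤n
𝟙≤1 false = z≤n

𝟙-mono : ∀ {b c} → (b ≡ true → c ≡ true) → 𝟙 b ≤ 𝟙 c
𝟙-mono {false} _   = z≤n
𝟙-mono {true}  b⇒c rewrite b⇒c refl = s≤s z≤n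

𝟙-∨ : ∀ {b c} → (b ∧ c) ≡ false → 𝟙 (b ∨ c) ≡ 𝟙 b + 𝟙 c
𝟙-∨ {true}  {true}  ()
𝟙-∨ {true}  {false} _ = refl
𝟙-∨ {false} {_}     _ = refl

𝟙≤ : ∀ b {y} → (b ≡ true → 1 ≤ y) → 𝟙 b ≤ y
𝟙≤ true  1≤y = 1≤y refl
𝟙≤ false _   = z≤n

*𝟙≤ : ∀ d b {x} → (b ≡ true → d ≤ x) → d * 𝟙 b ≤ x
*𝟙≤ d true  d≤x = ℕₚ.≤-trans (ℕₚ.≤-reflexive (ℕₚ.*-identityʳ d)) (d≤x refl)
*𝟙≤ d false _   = ℕₚ.≤-trans (ℕₚ.≤-reflexive (ℕₚ.*-zeroʳ d)) z≤n

_≡ᵇ_ : ∀ {n} → Fin n → Fin n → Bool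
i ≡ᵇ j = isYes (i F.≟ j)

≡ᵇ-refl : ∀ {n} (i : Fin n) → (i ≡ᵇ i) ≡ true
≡ᵇ-refl i = trans (isYes≗does (i F.≟ i)) (dec-true (i F.≟ i) refl)

≢⇒≡ᵇ-false : ∀ {n} {i j : Fin n} → i ≢ j → (i ≡ᵇ j) ≡ false
≢⇒≡ᵇ-false {i = i} {j} i≢j = trans (isYes≗does (i F.≟ j)) (dec-false (i F.≟ j) i≢j)

≡ᵇ⇒≡ : ∀ {n} {i j : Fin n} → (i ≡ᵇ j) ≡ true → i ≡ j
≡ᵇ⇒≡ {i = i} {j} eq with i F.≟ j
... | yes i≡j = i≡j

≡ᵇ-suc : ∀ {n} (i j : Fin n) → (fsuc i ≡ᵇ fsuc j) ≡ (i ≡ᵇ j)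
≡ᵇ-suc i j = ⌊⌋-map′ (cong fsuc) Finₚ.suc-injective (i F.≟ j)

≡ᵇ-sym : ∀ {n} (i j : Fin n) → (i ≡ᵇ j) ≡ (j ≡ᵇ i)
≡ᵇ-sym i j with i F.≟ j
... | yes refl = sym (≡ᵇ-refl i)
... | no i≢j   = sym (≢⇒≡ᵇ-false (i≢j ∘ sym))

sumℕ-cong : ∀ {n} {f g : Fin n → ℕ} → (∀ i → f i ≡ g i) → sumℕ f ≡ sumℕ g
sumℕ-cong {zero}  f≗g = refl
sumℕ-cong {suc n} f≗g = cong₂ _+_ (f≗g fzero) (sumℕ-cong (f≗g ∘ fsuc))

sumℕ-mono : ∀ {n} {f g : Fin n → ℕ} → (∀ i → f i ≤ g i) → sumℕ f ≤ sumℕ g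
sumℕ-mono {zero}  f≤g = z≤n
sumℕ-mono {suc n} f≤g = ℕₚ.+-mono-≤ (f≤g fzero) (sumℕ-mono (f≤g ∘ fsuc))

sumℕ-const : ∀ {n} c → sumℕ {n} (λ _ → c) ≡ n * c
sumℕ-const {zero}  c = refl
sumℕ-const {suc n} c = cong (c +_) (sumℕ-const {n} c)

sumℕ-zero : ∀ {n} {f : Fin n → ℕ} → (∀ i → f i ≡ 0) → sumℕ f ≡ 0
sumℕ-zero {n} f≗0 = trans (sumℕ-cong f≗0) (trans (sumℕ-const {n} 0) (ℕₚ.*-zeroʳ n))

sumℕ-+ : ∀ {n} (f g : Fin n → ℕ) → sumℕ (λ i → f i + g i) ≡ sumℕ f + sumℕ g
sumℕ-+ {zero}  f g = refl
sumℕ-+ {suc n} f g = trans (cong (f fzero + g fzero +_) (sumℕ-+ (f ∘ fsuc) (g ∘ fsuc)))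
                           (interchange (f fzero) (g fzero) (sumℕ (f ∘ fsuc)) (sumℕ (g ∘ fsuc)))
  where
  interchange : ∀ a b c d → a + b + (c + d) ≡ a + c + (b + d)
  interchange = solve-∀

sumℕ-suc : ∀ {n} (f : Fin n → ℕ) → sumℕ (λ i → suc (f i)) ≡ sumℕ f + n
sumℕ-suc {n} f = trans (sumℕ-+ (λ _ → 1) f)
  (trans (cong (_+ sumℕ f) (trans (sumℕ-const {n} 1) (ℕₚ.*-identityʳ n))) (ℕₚ.+-comm n (sumℕ f)))

sumℕ-*ˡ : ∀ {n} c (f : Fin n → ℕ) → sumℕ (λ i → c * f i) ≡ c * sumℕ f
sumℕ-*ˡ {zero}  c f = sym (ℕₚ.*-zeroʳ c)
sumℕ-*ˡ {suc n} c f = trans (cong (c * f fzero +_) (sumℕ-*ˡ c (f ∘ fsuc)))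
                            (sym (ℕₚ.*-distribˡ-+ c (f fzero) (sumℕ (f ∘ fsuc))))

sumℕ-swap : ∀ {m n} (f : Fin m → Fin n → ℕ) →
            sumℕ (λ i → sumℕ (f i)) ≡ sumℕ (λ j → sumℕ (λ i → f i j))
sumℕ-swap {zero}  {n} f = sym (sumℕ-zero {n} (λ _ → refl))
sumℕ-swap {suc m} {n} f = trans (cong (sumℕ (f fzero) +_) (sumℕ-swap (f ∘ fsuc)))
                                (sym (sumℕ-+ (f fzero) (λ j → sumℕ (λ i → f (fsuc i) j))))

sumℕ-pick : ∀ {n} (f : Fin n → ℕ) u → sumℕ f ≡ f u + sumℕ (λ j → if j ≡ᵇ u then 0 else f j)
sumℕ-pick {suc n} f fzero = cong (f fzero +_) (sumℕ-cong {n} λ _ → refl)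
sumℕ-pick {suc n} f (fsuc u) = begin
  f fzero + sumℕ (f ∘ fsuc)               ≡⟨ cong (f fzero +_) (sumℕ-pick (f ∘ fsuc) u) ⟩
  f fzero + (f (fsuc u) + rest)           ≡⟨ ℕₚ.+-comm (f fzero) _ ⟩
  f (fsuc u) + rest + f fzero             ≡⟨ ℕₚ.+-assoc (f (fsuc u)) rest (f fzero) ⟩
  f (fsuc u) + (rest + f fzero)           ≡⟨ cong (f (fsuc u) +_) (ℕₚ.+-comm rest (f fzero)) ⟩
  f (fsuc u) + (f fzero + rest)           ≡⟨ cong (λ z → f (fsuc u) + (f fzero + z)) (sumℕ-cong {n} λ j → cong (λ b → if b then 0 else f (fsuc j)) (sym (≡ᵇ-suc j u))) ⟩
  f (fsuc u) + sumℕ (λ j → if j ≡ᵇ fsuc u then 0 else f j) ∎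
  where
  open ≡-Reasoning
  rest = sumℕ (λ j → if j ≡ᵇ u then 0 else f (fsuc j))

sumℕ-pick₂ : ∀ {n} (f : Fin n → ℕ) {u w} → u ≢ w →
             sumℕ f ≡ f u + f w + sumℕ (λ x → if (x ≡ᵇ u) ∨ (x ≡ᵇ w) then 0 else f x)
sumℕ-pick₂ f {u} {w} u≢w = begin
  sumℕ f                                ≡⟨ sumℕ-pick f u ⟩
  f u + sumℕ f-u                        ≡⟨ cong (f u +_) (sumℕ-pick f-u w) ⟩
  f u + (f-u w + sumℕ f-u-w)            ≡⟨ cong (λ z → f u + (z + sumℕ f-u-w)) f-u[w]≡f[w] ⟩
  f u + (f w + sumℕ f-u-w)              ≡⟨ ℕₚ.+-assoc (f u) (f w) _ ⟨
  f u + f w + sumℕ f-u-w                ≡⟨ cong (f u + f w +_) (sumℕ-cong pointwise) ⟩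
  f u + f w + sumℕ (λ x → if (x ≡ᵇ u) ∨ (x ≡ᵇ w) then 0 else f x) ∎
  where
  open ≡-Reasoning
  f-u : Fin _ → ℕ
  f-u x = if x ≡ᵇ u then 0 else f x
  f-u-w : Fin _ → ℕ
  f-u-w x = if x ≡ᵇ w then 0 else f-u x
  f-u[w]≡f[w] : f-u w ≡ f w
  f-u[w]≡f[w] rewrite ≢⇒≡ᵇ-false (u≢w ∘ sym) = refl
  pointwise : ∀ x → f-u-w x ≡ (if (x ≡ᵇ u) ∨ (x ≡ᵇ w) then 0 else f x)
  pointwise x with x ≡ᵇ u | x ≡ᵇ w
  ... | true  | true  = refl
  ... | true  | false = refl
  ... | false | true  = refl
  ... | false | false = refl

sumℕ-≤1 : ∀ {n} (P : Fin n → Bool) → (∀ i j → P i ≡ true → P j ≡ true → i ≡ j) → sumℕ (𝟙 ∘ P) ≤ 1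
sumℕ-≤1 {zero}  P unique = z≤n
sumℕ-≤1 {suc n} P unique with P fzero in P0
... | false = sumℕ-≤1 (P ∘ fsuc) (λ i j Pi Pj → Finₚ.suc-injective (unique (fsuc i) (fsuc j) Pi Pj))
... | true  = ℕₚ.≤-reflexive (cong suc (sumℕ-zero rest-empty))
  where
  rest-empty : ∀ j → 𝟙 (P (fsuc j)) ≡ 0
  rest-empty j with P (fsuc j) in Pj
  ... | false = refl
  ... | true with () ← unique fzero (fsuc j) P0 Pj

sumℕ-δ : ∀ {n} (u : Fin n) → sumℕ (λ j → 𝟙 (j ≡ᵇ u)) ≡ 1
sumℕ-δ {suc n} fzero    = cong suc (sumℕ-zero {n} λ _ → refl)
sumℕ-δ {suc n} (fsuc u) = trans (sumℕ-cong λ j → cong 𝟙 (≡ᵇ-suc j u)) (sumℕ-δ u)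

sumℕ-∧δ : ∀ {n} b (u : Fin n) → sumℕ (λ j → 𝟙 (b ∧ (j ≡ᵇ u))) ≡ 𝟙 b
sumℕ-∧δ {n} false _ = sumℕ-zero {n} λ _ → refl
sumℕ-∧δ     true  u = sumℕ-δ u

ΣFin≡sumℕ : ∀ {n} (f : Fin n → ℕ) → ΣFin f ≡ sumℕ f
ΣFin≡sumℕ {n} f = go id
  where
  go : ∀ {m} (g : Fin m → Fin n) → sum (List.map f (List.tabulate g)) ≡ sumℕ (f ∘ g)
  go {zero}  g = refl
  go {suc m} g = cong (f (g fzero) +_) (go (g ∘ fsuc))

∈⇒lookup : ∀ {n} {v : Fin n} {S : Subset n} → v ∈ S → lookup S v ≡ true
∈⇒lookup = Vecₚ.[]=⇒lookup

lookup⇒∈ : ∀ {n} {v : Fin n} {S : Subset n} → lookup S v ≡ true → v ∈ S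
lookup⇒∈ {v = v} {S} = Vecₚ.lookup⇒[]= v S

lookup-∩ : ∀ {n} (p q : Subset n) v → lookup (p ∩ q) v ≡ lookup p v ∧ lookup q v
lookup-∩ p q v = Vecₚ.lookup-zipWith _∧_ v p q

∣∣≡sumℕ : ∀ {n} (S : Subset n) → ∣ S ∣ ≡ sumℕ (𝟙 ∘ lookup S)
∣∣≡sumℕ []          = refl
∣∣≡sumℕ (true ∷ S)  = cong suc (∣∣≡sumℕ S)
∣∣≡sumℕ (false ∷ S) = ∣∣≡sumℕ S

empty⇒∣∣≡0 : ∀ {n} {X : Subset n} → (∀ v → v ∉ X) → ∣ X ∣ ≡ 0
empty⇒∣∣≡0 {n} empty = trans (cong ∣_∣ (Empty-unique λ (v , v∈X) → empty v v∈X)) (∣⊥∣≡0 n)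

Nonempty-or-∣∣≡0 : ∀ {n} (S : Subset n) → Nonempty S ⊎ ∣ S ∣ ≡ 0
Nonempty-or-∣∣≡0 S with nonempty? S
... | yes S≠∅ = inj₁ S≠∅
... | no  S=∅ = inj₂ (empty⇒∣∣≡0 λ v v∈S → S=∅ (v , v∈S))

∈⇒0<∣∣ : ∀ {n} {x : Fin n} {p : Subset n} → x ∈ p → 0 < ∣ p ∣
∈⇒0<∣∣ x∈p = ℕₚ.≤-<-trans z≤n (x∈p⇒∣p-x∣<∣p∣ x∈p)

∣p∣≤∣p∩∁q∣+∣q∣ : ∀ {n} (p q : Subset n) → ∣ p ∣ ≤ ∣ p ∩ ∁ q ∣ + ∣ q ∣
∣p∣≤∣p∩∁q∣+∣q∣ []          []          = z≤n
∣p∣≤∣p∩∁q∣+∣q∣ (true ∷ p)  (true ∷ q)  = ℕₚ.≤-trans (s≤s (∣p∣≤∣p∩∁q∣+∣q∣ p q)) (ℕₚ.≤-reflexive (sym (ℕₚ.+-suc _ _)))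
∣p∣≤∣p∩∁q∣+∣q∣ (true ∷ p)  (false ∷ q) = s≤s (∣p∣≤∣p∩∁q∣+∣q∣ p q)
∣p∣≤∣p∩∁q∣+∣q∣ (false ∷ p) (true ∷ q)  = ℕₚ.≤-trans (∣p∣≤∣p∩∁q∣+∣q∣ p q) (ℕₚ.+-monoʳ-≤ ∣ p ∩ ∁ q ∣ (ℕₚ.n≤1+n ∣ q ∣))
∣p∣≤∣p∩∁q∣+∣q∣ (false ∷ p) (false ∷ q) = ∣p∣≤∣p∩∁q∣+∣q∣ p q

∣p∣≡1+∣p-x∣ : ∀ {n} {x : Fin n} {p : Subset n} → x ∈ p → ∣ p ∣ ≡ suc ∣ p - x ∣
∣p∣≡1+∣p-x∣ {p = true ∷ p}  here        = cong suc (cong ∣_∣ (sym (p─⊥≡p p)))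
∣p∣≡1+∣p-x∣ {p = true ∷ p}  (there x∈p) = cong suc (∣p∣≡1+∣p-x∣ x∈p)
∣p∣≡1+∣p-x∣ {p = false ∷ p} (there x∈p) = ∣p∣≡1+∣p-x∣ x∈p

x∉p-x : ∀ {n} (x : Fin n) (p : Subset n) → x ∉ p - x
x∉p-x fzero    (s ∷ p) ()
x∉p-x (fsuc x) (s ∷ p) (there x∈p-x) = x∉p-x x p x∈p-x

other-than? : ∀ {n} (T : Subset n) v → (∃[ w ] w ∈ T × w ≢ v) ⊎ ∣ T ∣ ≤ 1
other-than? T v with Finₚ.any? (λ w → w ∈? T ×-dec ¬? (w F.≟ v))
... | yes other = inj₁ other
... | no ¬other = inj₂ (ℕₚ.≤-trans (p⊆q⇒∣p∣≤∣q∣ T⊆⁅v⁆) (ℕₚ.≤-reflexive (∣⁅x⁆∣≡1 v)))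
  where
  T⊆⁅v⁆ : T ⊆ ⁅ v ⁆
  T⊆⁅v⁆ {w} w∈T with w F.≟ v
  ... | yes refl = x∈⁅x⁆ w
  ... | no w≢v   = ⊥-elim (¬other (w , w∈T , w≢v))

record IsSimple {n} (a : Adj n) : Set where
  field
    symmetric : ∀ u v → a u v ≡ a v u
    loopless  : ∀ u → a u u ≡ false

class-isSimple : ∀ {k n} (c : Colouring k n) i → IsSimple (class c i)
class-isSimple c i = record
  { symmetric = λ u v → cong₂ (λ b b′ → not b ∧ b′) (≡ᵇ-sym u v) (cong (_≡ᵇ i) (Colouring.sym c u v))
  ; loopless  = λ u → cong (λ b → not b ∧ _) (≡ᵇ-refl u)
  }

nbhd : ∀ {n} → Adj n → Fin n → Subset n
nbhd a v = tabulate (a v)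

lookup-nbhd : ∀ {n} (a : Adj n) v u → lookup (nbhd a v) u ≡ a v u
lookup-nbhd a v = Vecₚ.lookup∘tabulate (a v)

∈nbhd⁺ : ∀ {n} (a : Adj n) {v u} → a v u ≡ true → u ∈ nbhd a v
∈nbhd⁺ a {v} {u} avu = lookup⇒∈ (trans (lookup-nbhd a v u) avu)

∈nbhd⁻ : ∀ {n} (a : Adj n) {v u} → u ∈ nbhd a v → a v u ≡ true
∈nbhd⁻ a {v} {u} u∈N = trans (sym (lookup-nbhd a v u)) (∈⇒lookup u∈N)

degree : ∀ {n} → Adj n → Fin n → ℕ
degree a v = ∣ nbhd a v ∣

degree≡sumℕ : ∀ {n} (a : Adj n) v → degree a v ≡ sumℕ (𝟙 ∘ a v)
degree≡sumℕ a v = trans (∣∣≡sumℕ (nbhd a v)) (sumℕ-cong (cong 𝟙 ∘ lookup-nbhd a v))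

degIn≡sumℕ : ∀ {n} (a : Adj n) S v → degIn a S v ≡ sumℕ (λ u → 𝟙 (lookup S u ∧ a v u))
degIn≡sumℕ a S v = trans (∣∣≡sumℕ (S ∩ nbhd a v))
  (sumℕ-cong λ u → cong 𝟙 (trans (lookup-∩ S (nbhd a v) u) (cong (lookup S u ∧_) (lookup-nbhd a v u))))

edgeCount≡sumℕ : ∀ {n} (a : Adj n) → edgeCount a ≡ sumℕ (λ i → sumℕ (λ j → 𝟙 ((toℕ i <ᵇ toℕ j) ∧ a i j)))
edgeCount≡sumℕ a = trans (ΣFin≡sumℕ λ i → ΣFin λ j → 𝟙 ((toℕ i <ᵇ toℕ j) ∧ a i j)) (sumℕ-cong λ i → ΣFin≡sumℕ λ j → 𝟙 ((toℕ i <ᵇ toℕ j) ∧ a i j))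

module _ {n} {a : Adj n} (simple : IsSimple a) where
  open IsSimple simple

  private
    _<ᶠ_ : Fin n → Fin n → Bool
    i <ᶠ j = toℕ i <ᵇ toℕ j

    <ᶠ⇒< : ∀ {i j} → (i <ᶠ j) ≡ true → toℕ i < toℕ j
    <ᶠ⇒< {i} {j} i<j = ℕₚ.<ᵇ⇒< (toℕ i) (toℕ j) (subst T (sym i<j) _)

    ≮ᶠ⇒≮ : ∀ {i j} → (i <ᶠ j) ≡ false → ¬ toℕ i < toℕ j
    ≮ᶠ⇒≮ i≮j i<j = subst T i≮j (ℕₚ.<⇒<ᵇ i<j)

    𝟙-split : ∀ i j → 𝟙 (a i j) ≡ 𝟙 ((i <ᶠ j) ∧ a i j) + 𝟙 ((j <ᶠ i) ∧ a j i)
    𝟙-split i j with i <ᶠ j in i<j | j <ᶠ i in j<i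
    ... | true  | true  = ⊥-elim (ℕₚ.<-asym (<ᶠ⇒< {i} {j} i<j) (<ᶠ⇒< {j} {i} j<i))
    ... | true  | false = sym (ℕₚ.+-identityʳ _)
    ... | false | true  = cong 𝟙 (symmetric i j)
    ... | false | false
      with refl ← Finₚ.toℕ-injective (ℕₚ.≤-antisym (ℕₚ.≮⇒≥ (≮ᶠ⇒≮ {j} {i} j<i)) (ℕₚ.≮⇒≥ (≮ᶠ⇒≮ {i} {j} i<j)))
      = cong 𝟙 (loopless i)

  handshake : sumℕ (degree a) ≡ 2 * edgeCount a
  handshake = begin
    sumℕ (degree a)                                         ≡⟨ sumℕ-cong (degree≡sumℕ a) ⟩
    sumℕ (λ i → sumℕ (λ j → 𝟙 (a i j)))                    ≡⟨ sumℕ-cong (λ i → sumℕ-cong (𝟙-split i)) ⟩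
    sumℕ (λ i → sumℕ (λ j → below i j + below j i))        ≡⟨ sumℕ-cong (λ i → sumℕ-+ (below i) (λ j → below j i)) ⟩
    sumℕ (λ i → sumℕ (below i) + sumℕ (λ j → below j i))   ≡⟨ sumℕ-+ (λ i → sumℕ (below i)) _ ⟩
    e + sumℕ (λ i → sumℕ (λ j → below j i))                 ≡⟨ cong (e +_) (trans (sumℕ-swap (λ i j → below j i)) (sym (ℕₚ.+-identityʳ e))) ⟩
    2 * e                                                   ≡⟨ cong (2 *_) e≡edgeCount ⟩
    2 * edgeCount a                                         ∎
    where
    open ≡-Reasoning
    below : Fin n → Fin n → ℕ
    below i j = 𝟙 ((i <ᶠ j) ∧ a i j)
    e = sumℕ (λ i → sumℕ (below i))
    e≡edgeCount : e ≡ edgeCount a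
    e≡edgeCount = sym (edgeCount≡sumℕ a)

edgeCount-mono : ∀ {n} {h g : Adj n} → (∀ u v → h u v ≡ true → g u v ≡ true) → edgeCount h ≤ edgeCount g
edgeCount-mono {h = h} {g} h⊆g = subst₂ _≤_ (sym (edgeCount≡sumℕ h)) (sym (edgeCount≡sumℕ g))
  (sumℕ-mono λ i → sumℕ-mono λ j → 𝟙-mono λ e → let (i<j , hij) = ∧-true e in cong₂ _∧_ i<j (h⊆g i j hij))

two-neighbours≤degree : ∀ {n} (F : Adj n) {u w} → u ≢ w → ∀ x → 𝟙 (F x u) + 𝟙 (F x w) ≤ degree F x
two-neighbours≤degree F {u} {w} u≢w x = begin
  𝟙 (F x u) + 𝟙 (F x w)                                                           ≤⟨ ℕₚ.m≤m+n _ _ ⟩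
  𝟙 (F x u) + 𝟙 (F x w) + sumℕ (λ y → if (y ≡ᵇ u) ∨ (y ≡ᵇ w) then 0 else 𝟙 (F x y)) ≡⟨ sumℕ-pick₂ (𝟙 ∘ F x) u≢w ⟨
  sumℕ (𝟙 ∘ F x)                                                                  ≡⟨ degree≡sumℕ F x ⟨
  degree F x                                                                      ∎
  where open ℕₚ.≤-Reasoning

-- In 2e = Σₓ degree x, the vertices other than u and w contribute at least their edges to
-- u and w, that is degree u + degree w − 2.
degree-pair≤ : ∀ {n} {F : Adj n} → IsSimple F → ∀ {u w} → u ≢ w →
               degree F u + degree F w ≤ suc (edgeCount F)
degree-pair≤ {n} {F} simple {u} {w} u≢w = ℕₚ.*-cancelˡ-≤ 2 (begin
  2 * Δ              ≡⟨ double Δ ⟩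
  Δ + Δ              ≤⟨ ℕₚ.+-monoˡ-≤ Δ Δ≤2+R ⟩
  2 + R + Δ          ≡⟨ shuffle R Δ ⟩
  2 + (Δ + R)        ≤⟨ ℕₚ.+-monoʳ-≤ 2 Δ+R≤2e ⟩
  2 + 2 * edgeCount F ≡⟨ ℕₚ.*-distribˡ-+ 2 1 (edgeCount F) ⟨
  2 * suc (edgeCount F) ∎)
  where
  open ℕₚ.≤-Reasoning
  open IsSimple simple
  double : ∀ x → 2 * x ≡ x + x
  double = solve-∀
  shuffle : ∀ x y → 2 + x + y ≡ 2 + (y + x)
  shuffle = solve-∀
  Δ = degree F u + degree F w
  others : (Fin n → ℕ) → Fin n → ℕ
  others f x = if (x ≡ᵇ u) ∨ (x ≡ᵇ w) then 0 else f x
  D : Fin n → ℕ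
  D x = 𝟙 (F u x) + 𝟙 (F w x)
  R = sumℕ (others D)
  ΣD≡Δ : sumℕ D ≡ Δ
  ΣD≡Δ = trans (sumℕ-+ (𝟙 ∘ F u) (𝟙 ∘ F w)) (sym (cong₂ _+_ (degree≡sumℕ F u) (degree≡sumℕ F w)))
  Δ≤2+R : Δ ≤ 2 + R
  Δ≤2+R = begin
    Δ               ≡⟨ trans (sym ΣD≡Δ) (sumℕ-pick₂ D u≢w) ⟩
    D u + D w + R   ≤⟨ ℕₚ.+-monoˡ-≤ R (ℕₚ.+-mono-≤ Du≤1 Dw≤1) ⟩
    2 + R           ∎
    where
    Du≤1 : D u ≤ 1
    Du≤1 rewrite loopless u = 𝟙≤1 (F w u)
    Dw≤1 : D w ≤ 1
    Dw≤1 rewrite loopless w = ℕₚ.≤-trans (ℕₚ.≤-reflexive (ℕₚ.+-identityʳ _)) (𝟙≤1 (F u w))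
  Δ+R≤2e : Δ + R ≤ 2 * edgeCount F
  Δ+R≤2e = begin
    Δ + R                            ≤⟨ ℕₚ.+-monoʳ-≤ Δ (sumℕ-mono pointwise) ⟩
    Δ + sumℕ (others (degree F))     ≡⟨ sumℕ-pick₂ (degree F) u≢w ⟨
    sumℕ (degree F)                  ≡⟨ handshake simple ⟩
    2 * edgeCount F                  ∎
    where
    pointwise : ∀ x → others D x ≤ others (degree F) x
    pointwise x with (x ≡ᵇ u) ∨ (x ≡ᵇ w)
    ... | true  = z≤n
    ... | false = ℕₚ.≤-trans (ℕₚ.≤-reflexive (cong₂ (λ b c → 𝟙 b + 𝟙 c) (symmetric u x) (symmetric w x)))
                             (two-neighbours≤degree F u≢w x)

subgraph-isSimple : ∀ {n} {a : Adj n} {S h} → IsSimple a → IsSubgraph a S h → IsSimple h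
subgraph-isSimple {h = h} simple (h-sym , h⊆a) = record { symmetric = h-sym ; loopless = loopless }
  where
  loopless : ∀ u → h u u ≡ false
  loopless u with h u u in huu
  ... | false = refl
  ... | true  with () ← trans (sym (proj₂ (proj₂ (h⊆a u u huu)))) (IsSimple.loopless simple u)

degree<∣∣ : ∀ {n} {a : Adj n} {S h} → IsSimple a → IsSubgraph a S h → ∀ {u} → u ∈ S → degree h u < ∣ S ∣
degree<∣∣ {S = S} {h} simple h⊆a {u} u∈S =
  ℕₚ.≤-<-trans (p⊆q⇒∣p∣≤∣q∣ N⊆S-u) (x∈p⇒∣p-x∣<∣p∣ u∈S)
  where
  N⊆S-u : nbhd h u ⊆ S - u
  N⊆S-u {v} v∈N = x∈p∧x≢y⇒x∈p-y (proj₁ (proj₂ (proj₂ h⊆a u v (∈nbhd⁻ h v∈N)))) λ { refl →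
    true≢false (trans (sym (∈nbhd⁻ h v∈N)) (IsSimple.loopless (subgraph-isSimple simple h⊆a) u)) }

subgraph-edges≤ : ∀ {n} {a : Adj n} {S h} → IsSimple a → IsSubgraph a S h →
                  ∀ D → (∀ u → u ∈ S → degree h u ≤ D) → 2 * edgeCount h ≤ D * ∣ S ∣
subgraph-edges≤ {S = S} {h} simple h⊆a D degree≤D = begin
  2 * edgeCount h                  ≡⟨ handshake (subgraph-isSimple simple h⊆a) ⟨
  sumℕ (degree h)                  ≤⟨ sumℕ-mono pointwise ⟩
  sumℕ (λ u → D * 𝟙 (lookup S u))  ≡⟨ sumℕ-*ˡ D (𝟙 ∘ lookup S) ⟩
  D * sumℕ (𝟙 ∘ lookup S)          ≡⟨ cong (D *_) (∣∣≡sumℕ S) ⟨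
  D * ∣ S ∣                        ∎
  where
  open ℕₚ.≤-Reasoning
  pointwise : ∀ u → degree h u ≤ D * 𝟙 (lookup S u)
  pointwise u with lookup S u in Su
  ... | true  = ℕₚ.≤-trans (degree≤D u (lookup⇒∈ Su)) (ℕₚ.≤-reflexive (sym (ℕₚ.*-identityʳ D)))
  ... | false = ℕₚ.≤-reflexive (trans (empty⇒∣∣≡0 isolated) (sym (ℕₚ.*-zeroʳ D)))
    where
    isolated : ∀ v → v ∉ nbhd h u
    isolated v v∈N = true≢false (trans (sym (∈⇒lookup (proj₁ (proj₂ h⊆a u v (∈nbhd⁻ h v∈N))))) Su)

_↾_ : ∀ {n} → Adj n → Subset n → Adj n
(a ↾ S) u v = lookup S u ∧ (lookup S v ∧ a u v)

↾-isSubgraph : ∀ {n} {a : Adj n} → IsSimple a → ∀ S → IsSubgraph a S (a ↾ S)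
↾-isSubgraph {a = a} simple S = symmetric , inside
  where
  symmetric : ∀ u v → (a ↾ S) u v ≡ (a ↾ S) v u
  symmetric u v rewrite IsSimple.symmetric simple u v with lookup S u | lookup S v
  ... | true  | true  = refl
  ... | true  | false = refl
  ... | false | true  = refl
  ... | false | false = refl
  inside : ∀ u v → (a ↾ S) u v ≡ true → u ∈ S × v ∈ S × a u v ≡ true
  inside u v e with lookup S u in Su | lookup S v in Sv
  ... | true | true = lookup⇒∈ Su , lookup⇒∈ Sv , e

degree-↾ : ∀ {n} (a : Adj n) S {u} → u ∈ S → degree (a ↾ S) u ≡ degIn a S u
degree-↾ a S {u} u∈S = begin
  degree (a ↾ S) u                                ≡⟨ degree≡sumℕ (a ↾ S) u ⟩
  sumℕ (λ v → 𝟙 (lookup S u ∧ (lookup S v ∧ a u v))) ≡⟨ sumℕ-cong (λ v → cong (λ b → 𝟙 (b ∧ (lookup S v ∧ a u v))) (∈⇒lookup u∈S)) ⟩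
  sumℕ (λ v → 𝟙 (lookup S v ∧ a u v))             ≡⟨ degIn≡sumℕ a S u ⟨
  degIn a S u                                     ∎
  where open ≡-Reasoning

degIn<∣∣ : ∀ {n} {a : Adj n} → IsSimple a → ∀ {S v} → v ∈ S → degIn a S v < ∣ S ∣
degIn<∣∣ {a = a} simple {S} v∈S =
  subst (_< ∣ S ∣) (degree-↾ a S v∈S) (degree<∣∣ simple (↾-isSubgraph simple S) v∈S)

min-degree⇒edges : ∀ {n} {a : Adj n} → IsSimple a → ∀ d S →
                   (∀ u → u ∈ S → d ≤ degIn a S u) → d * ∣ S ∣ ≤ 2 * edgeCount (a ↾ S)
min-degree⇒edges {a = a} simple d S d≤degIn = begin
  d * ∣ S ∣                        ≡⟨ cong (d *_) (∣∣≡sumℕ S) ⟩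
  d * sumℕ (𝟙 ∘ lookup S)          ≡⟨ sumℕ-*ˡ d (𝟙 ∘ lookup S) ⟨
  sumℕ (λ u → d * 𝟙 (lookup S u))  ≤⟨ sumℕ-mono pointwise ⟩
  sumℕ (degree (a ↾ S))            ≡⟨ handshake (subgraph-isSimple simple (↾-isSubgraph simple S)) ⟩
  2 * edgeCount (a ↾ S)            ∎
  where
  open ℕₚ.≤-Reasoning
  pointwise : ∀ u → d * 𝟙 (lookup S u) ≤ degree (a ↾ S) u
  pointwise u = *𝟙≤ d (lookup S u) λ Su →
    ℕₚ.≤-trans (d≤degIn u (lookup⇒∈ Su)) (ℕₚ.≤-reflexive (sym (degree-↾ a S (lookup⇒∈ Su))))

clique⇒∣∣≤1+degIn : ∀ {n} {a : Adj n} {S v} → IsClique a S → v ∈ S → ∣ S ∣ ≤ suc (degIn a S v)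
clique⇒∣∣≤1+degIn {a = a} {S} {v} clique v∈S =
  ℕₚ.≤-trans (ℕₚ.≤-reflexive (∣p∣≡1+∣p-x∣ v∈S)) (s≤s (p⊆q⇒∣p∣≤∣q∣ S-v⊆N))
  where
  S-v⊆N : S - v ⊆ S ∩ nbhd a v
  S-v⊆N {u} u∈S-v = x∈p∩q⁺ (u∈S , ∈nbhd⁺ a (clique v u v∈S u∈S v≢u))
    where
    u∈S = p─q⊆p S ⁅ v ⁆ u∈S-v
    v≢u : v ≢ u
    v≢u refl = x∉p-x v S u∈S-v

clique-degIn : ∀ {n} {a : Adj n} → IsSimple a → ∀ {K d} → IsClique a K → ∣ K ∣ ≡ suc d →
               ∀ {v} → v ∈ K → degIn a K v ≡ d
clique-degIn {a = a} simple {K} clique ∣K∣≡1+d {v} v∈K = ℕₚ.≤-antisym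
  (ℕₚ.≤-pred (subst (degIn a K v <_) ∣K∣≡1+d (degIn<∣∣ simple v∈K)))
  (ℕₚ.≤-pred (subst (_≤ suc (degIn a K v)) ∣K∣≡1+d (clique⇒∣∣≤1+degIn clique v∈K)))

-- Degeneracy, colourings and cliques

Degenerate : ∀ {n} → Adj n → ℕ → Set
Degenerate {n} a d = ∀ (S : Subset n) → Nonempty S → ∃[ v ] v ∈ S × degIn a S v ≤ d

low-degree-or-dense : ∀ {n} {a : Adj n} → IsSimple a → ∀ d S →
  (∃[ v ] v ∈ S × degIn a S v ≤ d) ⊎ suc d * ∣ S ∣ ≤ 2 * edgeCount (a ↾ S)
low-degree-or-dense {a = a} simple d S with Finₚ.any? (λ v → v ∈? S ×-dec degIn a S v ℕₚ.≤? d)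
... | yes low = inj₁ low
... | no ¬low = inj₂ (min-degree⇒edges simple (suc d) S λ u u∈S → ℕₚ.≰⇒> λ le → ¬low (u , u∈S , le))

degenerate⇒clique≤ : ∀ {n} {a : Adj n} {d} → Degenerate a d → ∀ {S} → IsClique a S → ∣ S ∣ ≤ suc d
degenerate⇒clique≤ degenerate {S} clique with Nonempty-or-∣∣≡0 S
... | inj₂ ∣S∣≡0 = ℕₚ.≤-trans (ℕₚ.≤-reflexive ∣S∣≡0) z≤n
... | inj₁ S≠∅ with degenerate S S≠∅
... | v , v∈S , degIn≤d = ℕₚ.≤-trans (clique⇒∣∣≤1+degIn clique v∈S) (s≤s degIn≤d)

free-colour : ∀ {n k} (X : Subset n) → ∣ X ∣ < k → (g : Fin k → ℕ) → Injective _≡_ _≡_ g →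
              (φ : Fin n → ℕ) → ∃[ j ] ∀ {u} → u ∈ X → g j ≢ φ u
free-colour {k = suc k} [] _ g _ φ = fzero , λ ()
free-colour (false ∷ X) ∣X∣<k g g-inj φ with free-colour X ∣X∣<k g g-inj (φ ∘ fsuc)
... | j , free = j , λ { (there u∈X) → free u∈X }
free-colour {k = suc k} (true ∷ X) (s≤s ∣X∣<k) g g-inj φ with Finₚ.any? (λ j → g j ℕₚ.≟ φ fzero)
... | yes (j₀ , gj₀≡φ0) with free-colour X ∣X∣<k (g ∘ F.punchIn j₀) (Finₚ.punchIn-injective j₀ _ _ ∘ g-inj) (φ ∘ fsuc)
...   | j , free = F.punchIn j₀ j , λ
  { here gj≡φ0  → Finₚ.punchInᵢ≢i j₀ j (g-inj (trans gj≡φ0 (sym gj₀≡φ0)))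
  ; (there u∈X) → free u∈X }
free-colour {k = suc k} (true ∷ X) (s≤s ∣X∣<k) g g-inj φ | no ¬hit
  with free-colour X ∣X∣<k (g ∘ fsuc) (Finₚ.suc-injective ∘ g-inj) (φ ∘ fsuc)
...   | j , free = fsuc j , λ
  { here gj≡φ0  → ¬hit (fsuc j , gj≡φ0)
  ; (there u∈X) → free u∈X }

private
  module Greedy {n} {a : Adj n} (simple : IsSimple a) {d} (degenerate : Degenerate a d)
                (L : Fin n → Fin (suc d) → ℕ) (L-injective : ∀ v → Injective _≡_ _≡_ (L v)) where
    open IsSimple simple

    ProperOn : Subset n → (Fin n → Fin (suc d)) → Set
    ProperOn S f = ∀ {u w} → u ∈ S → w ∈ S → a u w ≡ true → L u (f u) ≢ L w (f w)

    list-colouring : ∀ m S → ∣ S ∣ < m → Σ (Fin n → Fin (suc d)) (ProperOn S)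
    list-colouring (suc m) S (s≤s ∣S∣≤m) with nonempty? S
    ... | no S=∅ = (λ _ → fzero) , λ u∈S → ⊥-elim (S=∅ (_ , u∈S))
    ... | yes S≠∅ with degenerate S S≠∅
    ... | v , v∈S , degIn≤d with list-colouring m (S - v) (ℕₚ.<-≤-trans (x∈p⇒∣p-x∣<∣p∣ v∈S) ∣S∣≤m)
    ... | f , proper with free-colour (S ∩ nbhd a v) (s≤s degIn≤d) (L v) (L-injective v) (λ u → L u (f u))
    ... | j , free = f′ , proper′
      where
      f′ : Fin n → Fin (suc d)
      f′ = updateAt f v (λ _ → j)
      proper′ : ProperOn S f′
      proper′ {u} {w} u∈S w∈S auw with u F.≟ v | w F.≟ v
      ... | yes refl | yes refl = ⊥-elim (true≢false (trans (sym auw) (loopless u)))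
      ... | yes refl | no w≢v
        rewrite updateAt-updates u {λ _ → j} f | updateAt-minimal w u {λ _ → j} f w≢v
        = free (x∈p∩q⁺ (w∈S , ∈nbhd⁺ a auw))
      ... | no u≢v | yes refl
        rewrite updateAt-updates w {λ _ → j} f | updateAt-minimal u w {λ _ → j} f u≢v
        = free (x∈p∩q⁺ (u∈S , ∈nbhd⁺ a (trans (symmetric w u) auw))) ∘ sym
      ... | no u≢v | no w≢v
        rewrite updateAt-minimal u v {λ _ → j} f u≢v | updateAt-minimal w v {λ _ → j} f w≢v
        = proper (x∈p∧x≢y⇒x∈p-y u∈S u≢v) (x∈p∧x≢y⇒x∈p-y w∈S w≢v) auw

degenerate⇒choosable : ∀ {n} {a : Adj n} {d} → IsSimple a → Degenerate a d → Choosable a (suc d)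
degenerate⇒choosable {n} simple degenerate L L-injective
  with Greedy.list-colouring simple degenerate L L-injective (suc n) ⊤ (s≤s (∣p∣≤n ⊤))
... | f , proper = f , λ u w → proper ∈⊤ ∈⊤

choosable⇒colourable : ∀ {n} {a : Adj n} {c} → Choosable a c → Σ (Fin n → Fin c) (IsProper a)
choosable⇒colourable choosable with choosable (λ _ → toℕ) (λ _ → Finₚ.toℕ-injective)
... | f , proper = f , λ u v auv fu≡fv → proper u v auv (cong toℕ fu≡fv)

colourable⇒clique≤ : ∀ {n c} {a : Adj n} {f : Fin n → Fin c} → IsProper a f →
                     ∀ {S} → IsClique a S → ∣ S ∣ ≤ c
colourable⇒clique≤ {n} {c} {a} {f} proper {S} clique = begin
  ∣ S ∣                                                ≡⟨ ∣∣≡sumℕ S ⟩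
  sumℕ (λ u → 𝟙 (lookup S u))                          ≡⟨ sumℕ-cong (λ u → sumℕ-∧δ (lookup S u) (f u)) ⟨
  sumℕ (λ u → sumℕ (λ j → 𝟙 (coloured u j)))           ≡⟨ sumℕ-swap (λ u j → 𝟙 (coloured u j)) ⟩
  sumℕ (λ j → sumℕ (λ u → 𝟙 (coloured u j)))           ≤⟨ sumℕ-mono (λ j → sumℕ-≤1 (λ u → coloured u j) (unique j)) ⟩
  sumℕ {c} (λ _ → 1)                                   ≡⟨ trans (sumℕ-const {c} 1) (ℕₚ.*-identityʳ c) ⟩
  c                                                    ∎
  where
  open ℕₚ.≤-Reasoning
  coloured : Fin n → Fin c → Bool
  coloured u j = lookup S u ∧ (j ≡ᵇ f u)
  unique : ∀ j u w → coloured u j ≡ true → coloured w j ≡ true → u ≡ w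
  unique j u w cu cw with ∧-true cu | ∧-true cw | u F.≟ w
  ... | _          | _          | yes u≡w = u≡w
  ... | Su , j≡fu  | Sw , j≡fw  | no u≢w  =
    ⊥-elim (proper u w (clique u w (lookup⇒∈ Su) (lookup⇒∈ Sw) u≢w) (trans (sym (≡ᵇ⇒≡ j≡fu)) (≡ᵇ⇒≡ j≡fw)))

-- Connectivity

reach-source : ∀ {n} {a : Adj n} {T u v} → Reach a T u v → u ∈ T
reach-source (here u∈T)     = u∈T
reach-source (step u∈T _ _) = u∈T

nbhd-separates : ∀ {n} {a : Adj n} → IsSimple a → ∀ {S v} → v ∈ S → VertexSeparates a S (S ∩ nbhd a v)
nbhd-separates {a = a} simple {S} {v} v∈S with other-than? (S ∩ ∁ (S ∩ nbhd a v)) v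
... | inj₂ ∣T∣≤1 = inj₁ ∣T∣≤1
... | inj₁ (w , w∈T , w≢v) = inj₂ λ connected → stuck (connected v w v∈T w∈T)
  where
  X = S ∩ nbhd a v
  v∉X : v ∉ X
  v∉X v∈X = true≢false (trans (sym (∈nbhd⁻ a (proj₂ (x∈p∩q⁻ S _ v∈X)))) (IsSimple.loopless simple v))
  v∈T : v ∈ S ∩ ∁ X
  v∈T = x∈p∩q⁺ (v∈S , x∉p⇒x∈∁p v∉X)
  stuck : Reach a (S ∩ ∁ X) v w → ⊥
  stuck (here _)          = w≢v refl
  stuck (step _ avy y⇝w) with x∈p∩q⁻ S (∁ X) (reach-source y⇝w)
  ... | y∈S , y∈∁X = x∈∁p⇒x∉p y∈∁X (x∈p∩q⁺ (y∈S , ∈nbhd⁺ a avy))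

star : ∀ {n} → Adj n → Subset n → Fin n → Adj n
star a S v x y = (lookup (S ∩ nbhd a v) y ∧ (x ≡ᵇ v)) ∨ (lookup (S ∩ nbhd a v) x ∧ (y ≡ᵇ v))

module _ {n} {a : Adj n} (simple : IsSimple a) {S : Subset n} {v : Fin n} (v∈S : v ∈ S) where
  open IsSimple simple

  private
    N : Fin n → Bool
    N = lookup (S ∩ nbhd a v)

    N⁺ : ∀ {y} → y ∈ S → a v y ≡ true → N y ≡ true
    N⁺ y∈S avy = ∈⇒lookup (x∈p∩q⁺ (y∈S , ∈nbhd⁺ a avy))

    N⁻ : ∀ {y} → N y ≡ true → y ∈ S × a v y ≡ true
    N⁻ Ny with x∈p∩q⁻ S (nbhd a v) (lookup⇒∈ Ny)
    ... | y∈S , y∈N = y∈S , ∈nbhd⁻ a y∈N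

    Nv≡false : N v ≡ false
    Nv≡false = trans (lookup-∩ S (nbhd a v) v)
      (trans (cong (lookup S v ∧_) (trans (lookup-nbhd a v v) (loopless v))) (Boolₚ.∧-zeroʳ _))

  star-isEdgeSet : IsEdgeSetIn a S (star a S v)
  star-isEdgeSet = (λ x y → Boolₚ.∨-comm (N y ∧ (x ≡ᵇ v)) (N x ∧ (y ≡ᵇ v))) , inside
    where
    inside : ∀ x y → star a S v x y ≡ true → x ∈ S × y ∈ S × a x y ≡ true
    inside x y e with ∨-true {N y ∧ (x ≡ᵇ v)} e
    ... | inj₁ e′ with ∧-true e′
    ...   | Ny , x≡v with refl ← ≡ᵇ⇒≡ {i = x} {v} x≡v = v∈S , N⁻ Ny
    inside x y e | inj₂ e′ with ∧-true e′
    ...   | Nx , y≡v with refl ← ≡ᵇ⇒≡ {i = y} {v} y≡v = proj₁ (N⁻ Nx) , v∈S , trans (symmetric x y) (proj₂ (N⁻ Nx))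

  star-separates : EdgeSeparates a S (star a S v)
  star-separates with other-than? S v
  ... | inj₂ ∣S∣≤1 = inj₁ ∣S∣≤1
  ... | inj₁ (w , w∈S , w≢v) = inj₂ λ connected → stuck (connected v w v∈S w∈S)
    where
    stuck : Reach (λ x y → a x y ∧ not (star a S v x y)) S v w → ⊥
    stuck (here _) = w≢v refl
    stuck (step {v = y} _ e y⇝w) with ∧-true e
    ... | avy , ¬star = true≢false (trans (sym ¬star) (cong not in-star))
      where
      in-star : star a S v v y ≡ true
      in-star = cong (_∨ (N v ∧ (y ≡ᵇ v))) (cong₂ _∧_ (N⁺ (reach-source y⇝w) avy) (≡ᵇ-refl v))

  edgeCount-star : edgeCount (star a S v) ≡ degIn a S v
  edgeCount-star = ℕₚ.*-cancelˡ-≡ _ _ 2 (begin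
    2 * edgeCount (star a S v)                               ≡⟨ handshake (subgraph-isSimple simple star-isEdgeSet) ⟨
    sumℕ (degree (star a S v))                               ≡⟨ sumℕ-cong degree-star ⟩
    sumℕ (λ x → sumℕ (λ y → 𝟙 (N y ∧ (x ≡ᵇ v))) + 𝟙 (N x)) ≡⟨ sumℕ-+ _ (𝟙 ∘ N) ⟩
    sumℕ (λ x → sumℕ (λ y → 𝟙 (N y ∧ (x ≡ᵇ v)))) + d        ≡⟨ cong (_+ d) (sumℕ-swap (λ x y → 𝟙 (N y ∧ (x ≡ᵇ v)))) ⟩
    sumℕ (λ y → sumℕ (λ x → 𝟙 (N y ∧ (x ≡ᵇ v)))) + d        ≡⟨ cong (_+ d) (sumℕ-cong (λ y → sumℕ-∧δ (N y) v)) ⟩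
    d + d                                                    ≡⟨ cong (d +_) (ℕₚ.+-identityʳ d) ⟨
    2 * d                                                    ≡⟨ cong (2 *_) (∣∣≡sumℕ (S ∩ nbhd a v)) ⟨
    2 * degIn a S v                                          ∎)
    where
    open ≡-Reasoning
    d = sumℕ (𝟙 ∘ N)
    disjoint : ∀ x y → ((N y ∧ (x ≡ᵇ v)) ∧ (N x ∧ (y ≡ᵇ v))) ≡ false
    disjoint x y with x ≡ᵇ v in x≡v | y ≡ᵇ v
    ... | false | w     = cong (_∧ (N x ∧ w)) (Boolₚ.∧-zeroʳ (N y))
    ... | true  | false = trans (cong ((N y ∧ true) ∧_) (Boolₚ.∧-zeroʳ (N x))) (Boolₚ.∧-zeroʳ _)
    ... | true  | true  with refl ← ≡ᵇ⇒≡ {i = x} {v} x≡v = trans (cong (λ b → (N y ∧ true) ∧ (b ∧ true)) Nv≡false) (Boolₚ.∧-zeroʳ _)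
    degree-star : ∀ x → degree (star a S v) x ≡ sumℕ (λ y → 𝟙 (N y ∧ (x ≡ᵇ v))) + 𝟙 (N x)
    degree-star x = begin
      degree (star a S v) x                                              ≡⟨ degree≡sumℕ (star a S v) x ⟩
      sumℕ (λ y → 𝟙 ((N y ∧ (x ≡ᵇ v)) ∨ (N x ∧ (y ≡ᵇ v))))               ≡⟨ sumℕ-cong (λ y → 𝟙-∨ {N y ∧ (x ≡ᵇ v)} (disjoint x y)) ⟩
      sumℕ (λ y → 𝟙 (N y ∧ (x ≡ᵇ v)) + 𝟙 (N x ∧ (y ≡ᵇ v)))               ≡⟨ sumℕ-+ (λ y → 𝟙 (N y ∧ (x ≡ᵇ v))) (λ y → 𝟙 (N x ∧ (y ≡ᵇ v))) ⟩
      sumℕ (λ y → 𝟙 (N y ∧ (x ≡ᵇ v))) + sumℕ (λ y → 𝟙 (N x ∧ (y ≡ᵇ v))) ≡⟨ cong (sumℕ (λ y → 𝟙 (N y ∧ (x ≡ᵇ v))) +_) (sumℕ-∧δ (N x) v) ⟩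
      sumℕ (λ y → 𝟙 (N y ∧ (x ≡ᵇ v))) + 𝟙 (N x)                         ∎

clique-connected : ∀ {n} {a : Adj n} {S} → IsClique a S → ∀ {T} → T ⊆ S → Connected a T
clique-connected clique T⊆S u w u∈T w∈T with u F.≟ w
... | yes refl = here u∈T
... | no u≢w   = step u∈T (clique u w (T⊆S u∈T) (T⊆S w∈T) u≢w) (here w∈T)

clique-vertexSeparator≥ : ∀ {n} {a : Adj n} {S d} → IsClique a S → ∣ S ∣ ≡ suc d →
                          ∀ {X} → VertexSeparates a S X → d ≤ ∣ X ∣
clique-vertexSeparator≥ {S = S} {d} clique ∣S∣≡1+d {X} (inj₁ ∣S-X∣≤1) = ℕₚ.≤-pred (begin
  suc d                 ≡⟨ ∣S∣≡1+d ⟨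
  ∣ S ∣                 ≤⟨ ∣p∣≤∣p∩∁q∣+∣q∣ S X ⟩
  ∣ S ∩ ∁ X ∣ + ∣ X ∣   ≤⟨ ℕₚ.+-monoˡ-≤ ∣ X ∣ ∣S-X∣≤1 ⟩
  suc ∣ X ∣             ∎)
  where open ℕₚ.≤-Reasoning
clique-vertexSeparator≥ {S = S} clique _ {X} (inj₂ disconnected) =
  ⊥-elim (disconnected (clique-connected clique (p∩q⊆p S (∁ X))))

covered⇒∣∣≤1+edges : ∀ {n} {F : Adj n} → IsSimple F → ∀ {u w} → u ≢ w → ∀ S →
                     (∀ {x} → x ∈ S → F u x ≡ true ⊎ F w x ≡ true) → ∣ S ∣ ≤ suc (edgeCount F)
covered⇒∣∣≤1+edges {F = F} simple {u} {w} u≢w S covered = begin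
  ∣ S ∣                              ≡⟨ ∣∣≡sumℕ S ⟩
  sumℕ (𝟙 ∘ lookup S)                ≤⟨ sumℕ-mono (λ x → 𝟙≤ (lookup S x) (one-of ∘ covered ∘ lookup⇒∈)) ⟩
  sumℕ (λ x → 𝟙 (F u x) + 𝟙 (F w x)) ≡⟨ sumℕ-+ (𝟙 ∘ F u) (𝟙 ∘ F w) ⟩
  sumℕ (𝟙 ∘ F u) + sumℕ (𝟙 ∘ F w)    ≡⟨ cong₂ _+_ (degree≡sumℕ F u) (degree≡sumℕ F w) ⟨
  degree F u + degree F w            ≤⟨ degree-pair≤ simple u≢w ⟩
  suc (edgeCount F)                  ∎
  where
  open ℕₚ.≤-Reasoning
  one-of : ∀ {x} → F u x ≡ true ⊎ F w x ≡ true → 1 ≤ 𝟙 (F u x) + 𝟙 (F w x)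
  one-of {x} (inj₁ Fux) rewrite Fux = s≤s z≤n
  one-of {x} (inj₂ Fwx) rewrite Fwx = ℕₚ.m≤n+m 1 (𝟙 (F u x))

clique-minus-edges-connected : ∀ {n} {a : Adj n} {S d} → IsSimple a → IsClique a S → ∣ S ∣ ≡ suc d →
                               ∀ {F} → IsEdgeSetIn a S F → edgeCount F < d →
                               Connected (λ x y → a x y ∧ not (F x y)) S
clique-minus-edges-connected {a = a} {S} {d} simple clique ∣S∣≡1+d {F} F⊆a e<d u w u∈S w∈S with u F.≟ w
... | yes refl = here u∈S
... | no u≢w with F u w in Fuw
...   | false = step u∈S (kept u∈S w∈S u≢w Fuw) (here w∈S)
  where
  kept : ∀ {x y} → x ∈ S → y ∈ S → x ≢ y → F x y ≡ false → (a x y ∧ not (F x y)) ≡ true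
  kept x∈S y∈S x≢y Fxy = cong₂ _∧_ (clique _ _ x∈S y∈S x≢y) (cong not Fxy)
...   | true with Finₚ.any? (λ x → x ∈? S ×-dec F u x Boolₚ.≟ false ×-dec F x w Boolₚ.≟ false)
...     | yes (x , x∈S , Fux , Fxw) = step u∈S (kept u∈S x∈S u≢x Fux) (step x∈S (kept x∈S w∈S x≢w Fxw) (here w∈S))
  where
  kept : ∀ {x y} → x ∈ S → y ∈ S → x ≢ y → F x y ≡ false → (a x y ∧ not (F x y)) ≡ true
  kept x∈S y∈S x≢y Fxy = cong₂ _∧_ (clique _ _ x∈S y∈S x≢y) (cong not Fxy)
  u≢x : u ≢ x
  u≢x refl = true≢false (trans (sym Fuw) Fxw)
  x≢w : x ≢ w
  x≢w refl = true≢false (trans (sym Fuw) Fux)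
...     | no ¬detour = ⊥-elim (ℕₚ.<⇒≱ e<d (ℕₚ.≤-pred
  (subst (_≤ suc (edgeCount F)) ∣S∣≡1+d (covered⇒∣∣≤1+edges (subgraph-isSimple simple F⊆a) u≢w S cover))))
  where
  open IsSimple (subgraph-isSimple simple F⊆a)
  cover : ∀ {x} → x ∈ S → F u x ≡ true ⊎ F w x ≡ true
  cover {x} x∈S with x F.≟ u | x F.≟ w
  ... | yes refl | _        = inj₂ (trans (symmetric w x) Fuw)
  ... | no _     | yes refl = inj₁ Fuw
  ... | no _     | no _ with F u x in Fux | F x w in Fxw
  ...   | true  | _     = inj₁ refl
  ...   | false | true  = inj₂ (trans (symmetric w x) Fxw)
  ...   | false | false = ⊥-elim (¬detour (x , x∈S , Fux , Fxw))

clique-edgeCut≥ : ∀ {n} {a : Adj n} {S d} → IsSimple a → IsClique a S → ∣ S ∣ ≡ suc d →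
                  ∀ {F} → IsEdgeSetIn a S F → EdgeSeparates a S F → d ≤ edgeCount F
clique-edgeCut≥ _ _ ∣S∣≡1+d _ (inj₁ ∣S∣≤1) =
  ℕₚ.≤-trans (ℕₚ.≤-pred (ℕₚ.≤-trans (ℕₚ.≤-reflexive (sym ∣S∣≡1+d)) ∣S∣≤1)) z≤n
clique-edgeCut≥ simple clique ∣S∣≡1+d F⊆a (inj₂ disconnected) =
  ℕₚ.≮⇒≥ λ e<d → disconnected (clique-minus-edges-connected simple clique ∣S∣≡1+d F⊆a e<d)

-- Opaque because unfolding it exposes the gcd normalisation of ℚ, which unification then
-- tries to evaluate on open terms.
opaque
  _/1+_ : ℕ → ℕ → ℚ
  a /1+ s = ℚ.fromℚᵘ (mkℚᵘ (ℤ.+ a) s)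

  fromℚᵘ≡/1+ : ∀ a s → ℚ.fromℚᵘ (mkℚᵘ (ℤ.+ a) s) ≡ a /1+ s
  fromℚᵘ≡/1+ a s = refl

  avgDeg≡/1+ : ∀ e {s} (nz : NonZero s) → avgDeg e s nz ≡ (2 * e) /1+ ℕ.pred s
  avgDeg≡/1+ e {suc s} _ = refl

  0/1+0≡0ℚ : 0 /1+ 0 ≡ ℚ.0ℚ
  0/1+0≡0ℚ = refl

toℚ : ℕ → ℚ
toℚ a = a /1+ 0

private
  toℚᵘ-/1+ : ∀ a s → ℚ.toℚᵘ (a /1+ s) ℚᵘ.≃ mkℚᵘ (ℤ.+ a) s
  toℚᵘ-/1+ a s = subst (λ q → ℚ.toℚᵘ q ℚᵘ.≃ mkℚᵘ (ℤ.+ a) s) (fromℚᵘ≡/1+ a s) (ℚₚ.toℚᵘ-fromℚᵘ (mkℚᵘ (ℤ.+ a) s))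

/1+-mono-≤ : ∀ {a s b t} → a * suc t ≤ b * suc s → a /1+ s ℚ.≤ b /1+ t
/1+-mono-≤ {a} {s} {b} {t} le = ℚₚ.toℚᵘ-cancel-≤
  (ℚᵘₚ.≤-respˡ-≃ (ℚᵘₚ.≃-sym (toℚᵘ-/1+ a s)) (ℚᵘₚ.≤-respʳ-≃ (ℚᵘₚ.≃-sym (toℚᵘ-/1+ b t))
    (ℚᵘ.*≤* (subst₂ ℤ._≤_ (ℤₚ.pos-* a (suc t)) (ℤₚ.pos-* b (suc s)) (ℤ.+≤+ le)))))

/1+-mono-< : ∀ {a s b t} → a * suc t < b * suc s → a /1+ s ℚ.< b /1+ t
/1+-mono-< {a} {s} {b} {t} lt = ℚₚ.toℚᵘ-cancel-<
  (ℚᵘₚ.<-respˡ-≃ (ℚᵘₚ.≃-sym (toℚᵘ-/1+ a s)) (ℚᵘₚ.<-respʳ-≃ (ℚᵘₚ.≃-sym (toℚᵘ-/1+ b t))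
    (ℚᵘ.*<* (subst₂ ℤ._<_ (ℤₚ.pos-* a (suc t)) (ℤₚ.pos-* b (suc s)) (ℤ.+<+ lt)))))

/1+-cancel-≤ : ∀ {a s b t} → a /1+ s ℚ.≤ b /1+ t → a * suc t ≤ b * suc s
/1+-cancel-≤ {a} {s} {b} {t} le
  with ℚᵘₚ.≤-respˡ-≃ (toℚᵘ-/1+ a s) (ℚᵘₚ.≤-respʳ-≃ (toℚᵘ-/1+ b t) (ℚₚ.toℚᵘ-mono-≤ le))
... | ℚᵘ.*≤* le′ = ℤₚ.drop‿+≤+ (subst₂ ℤ._≤_ (sym (ℤₚ.pos-* a (suc t))) (sym (ℤₚ.pos-* b (suc s))) le′)

/1+-cancel-< : ∀ {a s b t} → a /1+ s ℚ.< b /1+ t → a * suc t < b * suc s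
/1+-cancel-< {a} {s} {b} {t} lt
  with ℚᵘₚ.<-respˡ-≃ (toℚᵘ-/1+ a s) (ℚᵘₚ.<-respʳ-≃ (toℚᵘ-/1+ b t) (ℚₚ.toℚᵘ-mono-< lt))
... | ℚᵘ.*<* lt′ = ℤₚ.drop‿+<+ (subst₂ ℤ._<_ (sym (ℤₚ.pos-* a (suc t))) (sym (ℤₚ.pos-* b (suc s))) lt′)

toℚ-cancel-< : ∀ {a b} → toℚ a ℚ.< toℚ b → a < b
toℚ-cancel-< {a} {b} lt = subst₂ _<_ (ℕₚ.*-identityʳ a) (ℕₚ.*-identityʳ b) (/1+-cancel-< {a} {0} {b} {0} lt)

toℚ-mono-< : ∀ {a b} → a < b → toℚ a ℚ.< toℚ b
toℚ-mono-< {a} {b} a<b = /1+-mono-< {a} {0} {b} {0} (ℕₚ.*-monoˡ-< 1 a<b)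

toℚ-+ : ∀ a b → toℚ (a + b) ≡ toℚ a ℚ.+ toℚ b
toℚ-+ a b = ℚₚ.toℚᵘ-injective (ℚᵘₚ.≃-trans (toℚᵘ-/1+ (a + b) 0) (ℚᵘₚ.≃-sym
  (ℚᵘₚ.≃-trans (ℚₚ.toℚᵘ-homo-+ (toℚ a) (toℚ b)) (ℚᵘₚ.≃-trans (ℚᵘₚ.+-cong (toℚᵘ-/1+ a 0) (toℚᵘ-/1+ b 0)) sum≃))))
  where
  sum≃ : mkℚᵘ (ℤ.+ a) 0 ℚᵘ.+ mkℚᵘ (ℤ.+ b) 0 ℚᵘ.≃ mkℚᵘ (ℤ.+ (a + b)) 0
  sum≃ = ℚᵘ.*≡* (cong (ℤ._* ℤ.+ 1) (trans (cong₂ ℤ._+_ (ℤₚ.*-identityʳ (ℤ.+ a)) (ℤₚ.*-identityʳ (ℤ.+ b))) (sym (ℤₚ.pos-+ a b))))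

sumℚ-toℚ : ∀ {k} (f : Fin k → ℕ) → sumℚ (toℚ ∘ f) ≡ toℚ (sumℕ f)
sumℚ-toℚ {zero}  f = sym 0/1+0≡0ℚ
sumℚ-toℚ {suc k} f = trans (cong (toℚ (f fzero) ℚ.+_) (sumℚ-toℚ (f ∘ fsuc))) (sym (toℚ-+ (f fzero) (sumℕ (f ∘ fsuc))))

sumℚ-mono-≤ : ∀ {k} {x y : Fin k → ℚ} → (∀ i → x i ℚ.≤ y i) → sumℚ x ℚ.≤ sumℚ y
sumℚ-mono-≤ {zero}  x≤y = ℚₚ.≤-refl
sumℚ-mono-≤ {suc k} x≤y = ℚₚ.+-mono-≤ (x≤y fzero) (sumℚ-mono-≤ (x≤y ∘ fsuc))

sumℚ-mono-< : ∀ {k} {x y : Fin k → ℚ} → (∀ i → x i ℚ.≤ y i) → ∀ i → x i ℚ.< y i → sumℚ x ℚ.< sumℚ y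
sumℚ-mono-< x≤y fzero    x<y = ℚₚ.+-mono-<-≤ x<y (sumℚ-mono-≤ (x≤y ∘ fsuc))
sumℚ-mono-< x≤y (fsuc i) x<y = ℚₚ.+-mono-≤-< (x≤y fzero) (sumℚ-mono-< (x≤y ∘ fsuc) i x<y)

sumℚ-<-toℚ : ∀ {k} (x : Fin k → ℚ) (d : Fin k → ℕ) i₀ → (∀ i → i ≢ i₀ → x i ℚ.≤ toℚ (d i)) →
             x i₀ ℚ.< toℚ (suc (d i₀)) → sumℚ x ℚ.< toℚ (suc (sumℕ d))
sumℚ-<-toℚ x d i₀ x≤d x₀<d₀+1 = ℚₚ.<-≤-trans (sumℚ-mono-< x≤d′ i₀ x₀<d′₀) (ℚₚ.≤-reflexive (trans (sumℚ-toℚ d′) (cong toℚ Σd′≡)))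
  where
  d′ : Fin _ → ℕ
  d′ i = d i + 𝟙 (i ≡ᵇ i₀)
  x₀<d₀+1′ : x i₀ ℚ.< toℚ (d i₀ + 1)
  x₀<d₀+1′ = subst (λ z → x i₀ ℚ.< toℚ z) (ℕₚ.+-comm 1 (d i₀)) x₀<d₀+1
  x₀<d′₀ : x i₀ ℚ.< toℚ (d′ i₀)
  x₀<d′₀ = subst (λ b → x i₀ ℚ.< toℚ (d i₀ + 𝟙 b)) (sym (≡ᵇ-refl i₀)) x₀<d₀+1′
  x≤d′ : ∀ i → x i ℚ.≤ toℚ (d′ i)
  x≤d′ i with i F.≟ i₀
  ... | yes refl = ℚₚ.<⇒≤ x₀<d₀+1′
  ... | no i≢i₀  = subst (λ z → x i ℚ.≤ toℚ z) (sym (ℕₚ.+-identityʳ (d i))) (x≤d i i≢i₀)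
  Σd′≡ : sumℕ d′ ≡ suc (sumℕ d)
  Σd′≡ = trans (sumℕ-+ d (λ i → 𝟙 (i ≡ᵇ i₀))) (trans (cong (sumℕ d +_) (sumℕ-δ i₀)) (ℕₚ.+-comm (sumℕ d) 1))

record Floor (x : ℚ) : Set where
  field
    value    : ℕ
    floor≡   : floor x ≡ ℤ.+ value
    below    : toℚ value ℚ.≤ x
    greatest : ∀ z → toℚ z ℚ.≤ x → z ≤ value

nonneg-floor : ∀ x → toℚ 0 ℚ.≤ x → Floor x
nonneg-floor (mkℚ -[1+ _ ] _ _) 0≤x with ℚᵘₚ.≤-respˡ-≃ (toℚᵘ-/1+ 0 0) (ℚₚ.toℚᵘ-mono-≤ 0≤x)
... | ℚᵘ.*≤* ()
nonneg-floor x@(mkℚ (ℤ.+ num) den-1 _) _ = record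
  { value    = num ℕ./ suc den-1
  ; floor≡   = ℤₚ.*-identityˡ _
  ; below    = ℚₚ.≤-trans (/1+-mono-≤ {num ℕ./ suc den-1} {0} {num} {den-1} value*den≤num) (ℚₚ.≤-reflexive x≡)
  ; greatest = λ z z≤x → ℕₚ.≤-trans (ℕₚ.≤-reflexive (sym (ℕ.m*n/n≡m z (suc den-1))))
      (ℕ./-monoˡ-≤ (suc den-1) (ℕₚ.≤-trans (/1+-cancel-≤ {z} {0} {num} {den-1} (ℚₚ.≤-trans z≤x (ℚₚ.≤-reflexive (sym x≡))))
                                           (ℕₚ.≤-reflexive (ℕₚ.*-identityʳ num))))
  }
  where
  x≡ : num /1+ den-1 ≡ x
  x≡ = trans (sym (fromℚᵘ≡/1+ num den-1)) (ℚₚ.fromℚᵘ-toℚᵘ x)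
  value*den≤num : num ℕ./ suc den-1 * suc den-1 ≤ num * 1
  value*den≤num = ℕₚ.≤-trans (ℕ.m/n*n≤m num (suc den-1)) (ℕₚ.≤-reflexive (sym (ℕₚ.*-identityʳ num)))

-- Maximum average degree

Mad-nonneg : ∀ {n} {a : Adj n} {m} → Mad a m → toℚ 0 ℚ.≤ m
Mad-nonneg ((S , h , nz , _ , m≡) , _) =
  ℚₚ.≤-trans (/1+-mono-≤ {0} {0} {2 * edgeCount h} {ℕ.pred ∣ S ∣} z≤n) (ℚₚ.≤-reflexive (sym (trans m≡ (avgDeg≡/1+ (edgeCount h) nz))))

Mad≤ : ∀ {n} {a : Adj n} {m} → Mad a m → ∀ D →
       (∀ S h → IsSubgraph a S h → 2 * edgeCount h ≤ D * ∣ S ∣) → m ℚ.≤ toℚ D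
Mad≤ ((S , h , nz , h⊆a , m≡) , _) D sparse = ℚₚ.≤-trans (ℚₚ.≤-reflexive (trans m≡ (avgDeg≡/1+ (edgeCount h) nz)))
  (/1+-mono-≤ {2 * edgeCount h} {ℕ.pred ∣ S ∣} {D} {0}
    (subst₂ _≤_ (sym (ℕₚ.*-identityʳ (2 * edgeCount h))) (cong (D *_) (sym (ℕₚ.suc-pred ∣ S ∣ {{nz}}))) (sparse S h h⊆a)))

Mad< : ∀ {n} {a : Adj n} {m} → Mad a m → ∀ D →
       (∀ S h → IsSubgraph a S h → 0 < ∣ S ∣ → 2 * edgeCount h < D * ∣ S ∣) → m ℚ.< toℚ D
Mad< ((S , h , nz , h⊆a , m≡) , _) D sparse = ℚₚ.≤-<-trans (ℚₚ.≤-reflexive (trans m≡ (avgDeg≡/1+ (edgeCount h) nz)))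
  (/1+-mono-< {2 * edgeCount h} {ℕ.pred ∣ S ∣} {D} {0}
    (subst₂ _<_ (sym (ℕₚ.*-identityʳ (2 * edgeCount h))) (cong (D *_) (sym (ℕₚ.suc-pred ∣ S ∣ {{nz}})))
      (sparse S h h⊆a (ℕ.>-nonZero⁻¹ ∣ S ∣ {{nz}}))))

-- For S = ∅ this is the junk value 0/1, which density-attained realises on a singleton.
density : ∀ {n} → Adj n → Subset n → ℚ
density a S = (2 * edgeCount (a ↾ S)) /1+ ℕ.pred ∣ S ∣

argmax : ∀ {n} (f : Subset n → ℚ) → ∃[ S* ] ∀ S → f S ℚ.≤ f S*
argmax {zero}  f = [] , λ { [] → ℚₚ.≤-refl }
argmax {suc n} f with argmax (f ∘ (true ∷_)) | argmax (f ∘ (false ∷_))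
... | S₁ , max₁ | S₀ , max₀ with ℚₚ.≤-total (f (true ∷ S₁)) (f (false ∷ S₀))
... | inj₁ ≤₀ = false ∷ S₀ , λ { (true ∷ S) → ℚₚ.≤-trans (max₁ S) ≤₀ ; (false ∷ S) → max₀ S }
... | inj₂ ≤₁ = true ∷ S₁  , λ { (true ∷ S) → max₁ S ; (false ∷ S) → ℚₚ.≤-trans (max₀ S) ≤₁ }

density-attained : ∀ {n} {a : Adj n} → IsSimple a → Fin n → ∀ S →
                   ∃[ S′ ] ∃[ h ] Σ (NonZero ∣ S′ ∣) λ nz → IsSubgraph a S′ h × density a S ≡ avgDeg (edgeCount h) ∣ S′ ∣ nz
density-attained {n} {a} simple v S = [ nonempty , empty ]′ (Nonempty-or-∣∣≡0 S)
  where
  Attained : Set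
  Attained = ∃[ S′ ] ∃[ h ] Σ (NonZero ∣ S′ ∣) λ nz → IsSubgraph a S′ h × density a S ≡ avgDeg (edgeCount h) ∣ S′ ∣ nz
  nonempty : Nonempty S → Attained
  nonempty (u , u∈S) = S , a ↾ S , nz , ↾-isSubgraph simple S , sym (avgDeg≡/1+ (edgeCount (a ↾ S)) nz)
    where
    nz : NonZero ∣ S ∣
    nz = ℕ.>-nonZero (∈⇒0<∣∣ u∈S)
  empty : ∣ S ∣ ≡ 0 → Attained
  empty ∣S∣≡0 = ⁅ v ⁆ , a ↾ S , nz , (proj₁ (↾-isSubgraph simple S) , no-edges) ,
    trans (cong (λ s → (2 * edgeCount (a ↾ S)) /1+ ℕ.pred s) ∣S∣≡0)
          (sym (trans (avgDeg≡/1+ (edgeCount (a ↾ S)) nz) (cong (λ s → (2 * edgeCount (a ↾ S)) /1+ ℕ.pred s) (∣⁅x⁆∣≡1 v))))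
    where
    nz : NonZero ∣ ⁅ v ⁆ ∣
    nz = subst NonZero (sym (∣⁅x⁆∣≡1 v)) _
    no-edges : ∀ x y → (a ↾ S) x y ≡ true → x ∈ ⁅ v ⁆ × y ∈ ⁅ v ⁆ × a x y ≡ true
    no-edges x y e = ⊥-elim (ℕₚ.<⇒≢ (∈⇒0<∣∣ (proj₁ (proj₂ (↾-isSubgraph simple S) x y e))) (sym ∣S∣≡0))

density-bounds-Mad : ∀ {n} {a : Adj n} S* → (∀ S → density a S ℚ.≤ density a S*) →
                     ∀ S h (nz : NonZero ∣ S ∣) → IsSubgraph a S h → avgDeg (edgeCount h) ∣ S ∣ nz ℚ.≤ density a S*
density-bounds-Mad {a = a} S* maximal S h nz (_ , inside) = ℚₚ.≤-trans (ℚₚ.≤-reflexive (avgDeg≡/1+ (edgeCount h) nz))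
  (ℚₚ.≤-trans (/1+-mono-≤ (ℕₚ.*-monoˡ-≤ (suc (ℕ.pred ∣ S ∣)) (ℕₚ.*-monoʳ-≤ 2 (edgeCount-mono h⊆a↾S)))) (maximal S))
  where
  h⊆a↾S : ∀ x y → h x y ≡ true → (a ↾ S) x y ≡ true
  h⊆a↾S x y hxy = let (x∈S , y∈S , axy) = inside x y hxy in cong₂ _∧_ (∈⇒lookup x∈S) (cong₂ _∧_ (∈⇒lookup y∈S) axy)

Mad-exists : ∀ {n} {a : Adj n} → IsSimple a → Fin n → ∃ (Mad a)
Mad-exists {a = a} simple v =
  let (S* , maximal) = argmax (density a)
  in density a S* , density-attained simple v S* , density-bounds-Mad S* maximal

dense⇒Mad≥ : ∀ {n} {a : Adj n} {m} → IsSimple a → Mad a m → ∀ d S → 0 < ∣ S ∣ →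
             suc d * ∣ S ∣ ≤ 2 * edgeCount (a ↾ S) → toℚ (suc d) ℚ.≤ m
dense⇒Mad≥ {a = a} simple (_ , bounded) d S 0<∣S∣ dense = ℚₚ.≤-trans d+1≤avgDeg (bounded S (a ↾ S) nz (↾-isSubgraph simple S))
  where
  nz : NonZero ∣ S ∣
  nz = ℕ.>-nonZero 0<∣S∣
  d+1≤avgDeg : toℚ (suc d) ℚ.≤ avgDeg (edgeCount (a ↾ S)) ∣ S ∣ nz
  d+1≤avgDeg = ℚₚ.≤-trans
    (/1+-mono-≤ {suc d} {0} {2 * edgeCount (a ↾ S)} {ℕ.pred ∣ S ∣}
      (subst₂ _≤_ (cong (suc d *_) (sym (ℕₚ.suc-pred ∣ S ∣ {{nz}}))) (sym (ℕₚ.*-identityʳ (2 * edgeCount (a ↾ S)))) dense))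
    (ℚₚ.≤-reflexive (sym (avgDeg≡/1+ (edgeCount (a ↾ S)) nz)))

Mad⇒degenerate : ∀ {n} {a : Adj n} {m} → IsSimple a → Mad a m →
                 ∀ d → (∀ z → toℚ z ℚ.≤ m → z ≤ d) → Degenerate a d
Mad⇒degenerate simple mad d greatest S (v , v∈S) =
  [ id , (λ dense → ⊥-elim (ℕₚ.<-irrefl refl (greatest (suc d) (dense⇒Mad≥ simple mad d S (∈⇒0<∣∣ v∈S) dense)))) ]′
    (low-degree-or-dense simple d S)

Mad<⇒degenerate : ∀ {n} {a : Adj n} {m} → IsSimple a → Mad a m → ∀ d → m ℚ.< toℚ (suc d) → Degenerate a d
Mad<⇒degenerate simple mad d m<d+1 =
  Mad⇒degenerate simple mad d λ z z≤m → ℕₚ.≤-pred (toℚ-cancel-< (ℚₚ.≤-<-trans z≤m m<d+1))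

module _ {n} {a : Adj n} (simple : IsSimple a) {d} (degenerate : Degenerate a d) where

  cliqueNumber≤ : ∀ {x} → CliqueNumber a x → x ≤ suc d
  cliqueNumber≤ ((_ , clique , refl) , _) = degenerate⇒clique≤ degenerate clique

  chromaticNumber≤ : ∀ {x} → ChromaticNumber a x → x ≤ suc d
  chromaticNumber≤ (_ , minimal) with choosable⇒colourable (degenerate⇒choosable simple degenerate)
  ... | f , proper = minimal (suc d) f proper

  choiceNumber≤ : ∀ {x} → ChoiceNumber a x → x ≤ suc d
  choiceNumber≤ (_ , minimal) = minimal (suc d) (degenerate⇒choosable simple degenerate)

  minDegree≤ : ∀ {S m} → Nonempty S → MinDegree a S m → m ≤ d
  minDegree≤ S≠∅ (_ , minimal) with degenerate _ S≠∅
  ... | v , v∈S , degIn≤d = ℕₚ.≤-trans (minimal v v∈S) degIn≤d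

  degeneracy≤ : ∀ {x} → Degeneracy a x → x ≤ d
  degeneracy≤ ((_ , S≠∅ , minDegree) , _) = minDegree≤ S≠∅ minDegree

  colouringNumber≤ : ∀ {x} → ColouringNumber a x → x ≤ suc d
  colouringNumber≤ (_ , degeneracy , refl) = s≤s (degeneracy≤ degeneracy)

  vertexConnectivity≤ : ∀ {S m} → Nonempty S → VertexConnectivity a S m → m ≤ d
  vertexConnectivity≤ {S} S≠∅ (_ , minimal) with degenerate S S≠∅
  ... | v , v∈S , degIn≤d = ℕₚ.≤-trans (minimal _ (p∩q⊆p S (nbhd a v)) (nbhd-separates simple v∈S)) degIn≤d

  kappaStar≤ : ∀ {x} → KappaStar a x → x ≤ d
  kappaStar≤ ((_ , S≠∅ , κ) , _) = vertexConnectivity≤ S≠∅ κ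

  edgeConnectivity≤ : ∀ {S m} → Nonempty S → EdgeConnectivity a S m → m ≤ d
  edgeConnectivity≤ {S} S≠∅ (_ , minimal) with degenerate S S≠∅
  ... | v , v∈S , degIn≤d = ℕₚ.≤-trans (minimal _ (star-isEdgeSet simple v∈S) (star-separates simple v∈S))
                              (ℕₚ.≤-trans (ℕₚ.≤-reflexive (edgeCount-star simple v∈S)) degIn≤d)

  lambdaStar≤ : ∀ {x} → LambdaStar a x → x ≤ d
  lambdaStar≤ ((_ , S≠∅ , λ′) , _) = edgeConnectivity≤ S≠∅ λ′

Tight : ∀ {n} → Adj n → ℕ → Set
Tight a d = ContainsK a (suc d) × Degenerate a d

module _ {n} {a : Adj n} (simple : IsSimple a) {d} (tight : Tight a d) where
  private
    K = proj₁ (proj₁ tight)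
    clique = proj₁ (proj₂ (proj₁ tight))
    ∣K∣≡1+d = proj₂ (proj₂ (proj₁ tight))
    degenerate = proj₂ tight
    K≠∅ : Nonempty K
    K≠∅ with Nonempty-or-∣∣≡0 K
    ... | inj₁ K≠∅   = K≠∅
    ... | inj₂ ∣K∣≡0 with () ← trans (sym ∣K∣≡1+d) ∣K∣≡0
    v = proj₁ K≠∅
    v∈K = proj₂ K≠∅
    degIn≡d = clique-degIn simple clique ∣K∣≡1+d v∈K

  tight⇒cliqueNumber : CliqueNumber a (suc d)
  tight⇒cliqueNumber = (K , clique , ∣K∣≡1+d) , λ _ → degenerate⇒clique≤ degenerate

  tight⇒chromaticNumber : ChromaticNumber a (suc d)
  tight⇒chromaticNumber = choosable⇒colourable (degenerate⇒choosable simple degenerate) ,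
    λ c f proper → subst (_≤ c) ∣K∣≡1+d (colourable⇒clique≤ proper clique)

  tight⇒choiceNumber : ChoiceNumber a (suc d)
  tight⇒choiceNumber = degenerate⇒choosable simple degenerate ,
    λ c choosable → subst (_≤ c) ∣K∣≡1+d (colourable⇒clique≤ (proj₂ (choosable⇒colourable choosable)) clique)

  tight⇒degeneracy : Degeneracy a d
  tight⇒degeneracy = (K , K≠∅ , (v , v∈K , degIn≡d) , λ u u∈K → ℕₚ.≤-reflexive (sym (clique-degIn simple clique ∣K∣≡1+d u∈K))) ,
    λ _ _ → minDegree≤ simple degenerate

  tight⇒colouringNumber : ColouringNumber a (suc d)
  tight⇒colouringNumber = d , tight⇒degeneracy , refl

  tight⇒kappaStar : KappaStar a d
  tight⇒kappaStar = (K , K≠∅ , (K ∩ nbhd a v , p∩q⊆p K (nbhd a v) , nbhd-separates simple v∈K , degIn≡d) ,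
                       λ _ _ → clique-vertexSeparator≥ clique ∣K∣≡1+d) ,
                    λ _ _ → vertexConnectivity≤ simple degenerate

  tight⇒lambdaStar : LambdaStar a d
  tight⇒lambdaStar = (K , K≠∅ , (star a K v , star-isEdgeSet simple v∈K , star-separates simple v∈K ,
                                  trans (edgeCount-star simple v∈K) degIn≡d) ,
                        λ _ → clique-edgeCut≥ simple clique ∣K∣≡1+d) ,
                     λ _ _ → edgeConnectivity≤ simple degenerate

-- Packings

completePlusIsolated⇒containsK : ∀ {n} {a : Adj n} {m} → IsCompletePlusIsolated a m → ContainsK a m
completePlusIsolated⇒containsK (K , ∣K∣≡m , _ , clique) = K , clique , ∣K∣≡m

completePlusIsolated-degree≤ : ∀ {n} {a : Adj n} → IsSimple a → ∀ {d} →
                               IsCompletePlusIsolated a (suc d) → ∀ u → degree a u ≤ d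
completePlusIsolated-degree≤ {a = a} simple (K , ∣K∣≡1+d , inside , _) u with u ∈? K
... | yes u∈K = ℕₚ.≤-pred (subst (_ <_) ∣K∣≡1+d (degree<∣∣ simple a⊆K u∈K))
  where
  a⊆K : IsSubgraph a K a
  a⊆K = IsSimple.symmetric simple , λ x y axy → proj₁ (inside x y axy) , proj₁ (proj₂ (inside x y axy)) , axy
... | no  u∉K = ℕₚ.≤-trans (ℕₚ.≤-reflexive (empty⇒∣∣≡0 λ v v∈N → u∉K (proj₁ (inside u v (∈nbhd⁻ a v∈N))))) z≤n

completePlusIsolated-Mad≤ : ∀ {n} {a : Adj n} → IsSimple a → ∀ {d m} →
                            IsCompletePlusIsolated a (suc d) → Mad a m → m ℚ.≤ toℚ d
completePlusIsolated-Mad≤ {a = a} simple {d} complete mad = Mad≤ mad d λ S h h⊆a →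
  subgraph-edges≤ simple h⊆a d λ u _ → ℕₚ.≤-trans (p⊆q⇒∣p∣≤∣q∣ (nbhd-mono h⊆a u)) (completePlusIsolated-degree≤ simple complete u)
  where
  nbhd-mono : ∀ {S h} → IsSubgraph a S h → ∀ u → nbhd h u ⊆ nbhd a u
  nbhd-mono {h = h} (_ , inside) u v∈N = ∈nbhd⁺ a (proj₂ (proj₂ (inside u _ (∈nbhd⁻ h v∈N))))

2*pC2+p≡p*p : ∀ p → 2 * (p C 2) + p ≡ p * p
2*pC2+p≡p*p zero    = refl
2*pC2+p≡p*p (suc p) = begin
  2 * (suc p C 2) + suc p         ≡⟨ cong (λ z → 2 * z + suc p) (sym (nCk+nC[k+1]≡[n+1]C[k+1] p 1)) ⟩
  2 * (p C 1 + p C 2) + suc p     ≡⟨ cong (λ z → 2 * (z + p C 2) + suc p) (nC1≡n p) ⟩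
  2 * (p + p C 2) + suc p         ≡⟨ regroup (p C 2) p ⟩
  (2 * (p C 2) + p) + (2 * p + 1) ≡⟨ cong (_+ (2 * p + 1)) (2*pC2+p≡p*p p) ⟩
  p * p + (2 * p + 1)             ≡⟨ square (p) ⟩
  suc p * suc p                   ∎
  where
  open ≡-Reasoning
  regroup : ∀ x p → 2 * (p + x) + suc p ≡ (2 * x + p) + (2 * p + 1)
  regroup = solve-∀
  square : ∀ p → p * p + (2 * p + 1) ≡ suc p * suc p
  square = solve-∀

-- If ∣S∣ ≤ p all degrees in h are below ∣S∣; otherwise 2e(h) ≤ p(p − 1) + 2r < p(p + 1) ≤ p∣S∣.
family-sparse : ∀ {n} {a : Adj n} → IsSimple a → ∀ {p r} → edgeCount a ≡ p C 2 + r → r < p →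
                ∀ S h → IsSubgraph a S h → 0 < ∣ S ∣ → 2 * edgeCount h < p * ∣ S ∣
family-sparse {a = a} simple {p} {r} e≡ r<p S h h⊆a 0<∣S∣ with ∣ S ∣ ℕₚ.≤? p
... | yes ∣S∣≤p = ℕₚ.≤-<-trans
  (subgraph-edges≤ simple h⊆a (ℕ.pred ∣ S ∣) λ u u∈S → ℕₚ.<⇒≤pred (degree<∣∣ simple h⊆a u∈S))
  (ℕₚ.*-monoˡ-< ∣ S ∣ {{nz}} (ℕₚ.<-≤-trans (ℕₚ.≤-reflexive (ℕₚ.suc-pred ∣ S ∣ {{nz}})) ∣S∣≤p))
  where nz = ℕ.>-nonZero 0<∣S∣
... | no ∣S∣≰p = ℕₚ.+-cancelˡ-≤ p _ _ (begin
  p + suc (2 * edgeCount h)     ≤⟨ ℕₚ.+-monoʳ-≤ p (s≤s (ℕₚ.*-monoʳ-≤ 2 (edgeCount-mono λ u v huv → proj₂ (proj₂ (proj₂ h⊆a u v huv))))) ⟩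
  p + suc (2 * edgeCount a)     ≡⟨ cong (λ e → p + suc (2 * e)) e≡ ⟩
  p + suc (2 * (p C 2 + r))     ≡⟨ regroup (p C 2) p r ⟩
  2 * (p C 2) + p + suc (2 * r) ≡⟨ cong (_+ suc (2 * r)) (2*pC2+p≡p*p p) ⟩
  p * p + suc (2 * r)           ≤⟨ ℕₚ.+-monoʳ-≤ (p * p) (ℕₚ.≤-trans (ℕₚ.n≤1+n _) (ℕₚ.≤-trans (ℕₚ.≤-reflexive (sym (ℕₚ.*-distribˡ-+ 2 1 r))) (ℕₚ.*-monoʳ-≤ 2 r<p))) ⟩
  p * p + 2 * p                 ≡⟨ expand p ⟩
  p + p * suc p                 ≤⟨ ℕₚ.+-monoʳ-≤ p (ℕₚ.*-monoʳ-≤ p (ℕₚ.≰⇒> ∣S∣≰p)) ⟩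
  p + p * ∣ S ∣                 ∎)
  where
  open ℕₚ.≤-Reasoning
  regroup : ∀ x p r → p + suc (2 * (x + r)) ≡ 2 * x + p + suc (2 * r)
  regroup = solve-∀
  expand : ∀ p → p * p + 2 * p ≡ p + p * suc p
  expand = solve-∀

family-containsK : ∀ {n} {a : Adj n} {p r} → InF p r a → (p ≤ suc (2 * r) → CliqueNumber a p) → ContainsK a p
family-containsK (_ , inj₁ (_ , K))                cliqueNumber = K
family-containsK (_ , inj₂ (inj₁ (p≡2r+1 , _)))    cliqueNumber = proj₁ (cliqueNumber (ℕₚ.≤-reflexive (sym p≡2r+1)))
family-containsK (_ , inj₂ (inj₂ (p<2r+1 , _)))    cliqueNumber = proj₁ (cliqueNumber (ℕₚ.<⇒≤ p<2r+1))

record Certificate (k n F : ℕ) : Set where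
  field
    colouring : Colouring k n
    degrees   : Fin k → ℕ
    tight     : ∀ i → Tight (class colouring i) (degrees i)
    floor≤    : F ≤ sumℕ degrees

certificate : ∀ {k n M} (F : Floor M) (c : Colouring k n) (d : Fin k → ℕ) →
              (∀ i → ContainsK (class c i) (suc (d i))) → (vals : Fin k → ℚ) →
              (∀ i → Mad (class c i) (vals i)) → sumℚ vals ≡ M →
              (∀ i → vals i ℚ.< toℚ (suc (d i))) → sumℚ vals ℚ.< toℚ (suc (sumℕ d)) →
              Certificate k n (Floor.value F)
certificate F c d cliques vals mads Σvals≡M vals<d+1 Σvals<Σd+1 = record
  { colouring = c
  ; degrees   = d
  ; tight     = λ i → cliques i , Mad<⇒degenerate (class-isSimple c i) (mads i) (d i) (vals<d+1 i)
  ; floor≤    = ℕₚ.≤-pred (toℚ-cancel-< (ℚₚ.≤-<-trans (Floor.below F) (subst (ℚ._< toℚ (suc (sumℕ d))) Σvals≡M Σvals<Σd+1)))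
  }

packingDegree : ∀ {k} → Subset k → ℕ → Fin k → ℕ
packingDegree T p i = if isYes (i ∈? T) then suc p else p

packingDegree-∉ : ∀ {k} {T : Subset k} {p i} → i ∉ T → packingDegree T p i ≡ p
packingDegree-∉ {T = T} {i = i} i∉T with i ∈? T
... | yes i∈T = ⊥-elim (i∉T i∈T)
... | no  _   = refl

packing-complete : ∀ {k n p} {c : Colouring k n} {T} →
                   (∀ i → i ∈ T → IsCompletePlusIsolated (class c i) (suc (suc p))) →
                   ∀ i → (i ∉ T → IsCompletePlusIsolated (class c i) (suc p)) →
                   IsCompletePlusIsolated (class c i) (suc (packingDegree T p i))
packing-complete {T = T} big i small with i ∈? T
... | yes i∈T = big i i∈T
... | no  i∉T = small i∉T

type1-certificate : ∀ {k n p q r M} (F : Floor M) → Type1 k n (suc p) q r M → Certificate k n (Floor.value F)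
type1-certificate {p = p} F (_ , c , T , _ , big , small , vals , mads , Σvals≡M) =
  certificate F c d (completePlusIsolated⇒containsK ∘ complete) vals mads Σvals≡M
    (λ i → ℚₚ.≤-<-trans (vals≤d i) (toℚ-mono-< ℕₚ.≤-refl))
    (ℚₚ.≤-<-trans (sumℚ-mono-≤ vals≤d) (ℚₚ.≤-<-trans (ℚₚ.≤-reflexive (sumℚ-toℚ d)) (toℚ-mono-< ℕₚ.≤-refl)))
  where
  d = packingDegree T p
  complete : ∀ i → IsCompletePlusIsolated (class c i) (suc (d i))
  complete i = packing-complete {p = p} {c = c} {T = T} big i (small i)
  vals≤d : ∀ i → vals i ℚ.≤ toℚ (d i)
  vals≤d i = completePlusIsolated-Mad≤ (class-isSimple c i) (complete i) (mads i)

type2-cliques : ∀ {k n p} {c : Colouring k n} {T i₀} → i₀ ∉ T →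
                (∀ i → i ∈ T → IsCompletePlusIsolated (class c i) (suc (suc p))) →
                (∀ i → i ∉ T → i ≢ i₀ → IsCompletePlusIsolated (class c i) (suc p)) →
                ContainsK (class c i₀) (suc p) →
                ∀ i → ContainsK (class c i) (suc (packingDegree T p i))
type2-cliques {p = p} {c = c} {T} {i₀} i₀∉T big small K₀ i with i F.≟ i₀
... | yes refl = subst (ContainsK (class c i₀) ∘ suc) (sym (packingDegree-∉ {T = T} {p} i₀∉T)) K₀
... | no i≢i₀  = completePlusIsolated⇒containsK (packing-complete {p = p} {c = c} {T = T} big i λ i∉T → small i i∉T i≢i₀)

type2-certificate : ∀ {k n p q r M} (F : Floor M) → Type2 k n (suc p) q r M → Certificate k n (Floor.value F)
type2-certificate {p = p} F (_ , r<p , c , i₀ , T , i₀∉T , _ , big , small , inF , cliqueNumber , vals , mads , Σvals≡M) =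
  certificate F c d (type2-cliques {p = p} {c = c} {T} i₀∉T big small (family-containsK inF cliqueNumber)) vals mads Σvals≡M
    (λ i → vals<d+1 i (i F.≟ i₀)) (sumℚ-<-toℚ vals d i₀ vals≤d vals₀<d₀+1)
  where
  d = packingDegree T p
  vals₀<d₀+1 : vals i₀ ℚ.< toℚ (suc (d i₀))
  vals₀<d₀+1 = subst (λ z → vals i₀ ℚ.< toℚ (suc z)) (sym (packingDegree-∉ {T = T} {p} i₀∉T))
    (Mad< (mads i₀) (suc p) (family-sparse (class-isSimple c i₀) (proj₁ inF) r<p))
  vals≤d : ∀ i → i ≢ i₀ → vals i ℚ.≤ toℚ (d i)
  vals≤d i i≢i₀ = completePlusIsolated-Mad≤ (class-isSimple c i) (packing-complete {p = p} {c = c} {T = T} big i λ i∉T → small i i∉T i≢i₀) (mads i)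
  vals<d+1 : ∀ i → Dec (i ≡ i₀) → vals i ℚ.< toℚ (suc (d i))
  vals<d+1 i (yes refl) = vals₀<d₀+1
  vals<d+1 i (no i≢i₀)  = ℚₚ.≤-<-trans (vals≤d i i≢i₀) (toℚ-mono-< ℕₚ.≤-refl)

MaxMad-nonneg : ∀ {k n M} → MaxMad k n M → toℚ 0 ℚ.≤ M
MaxMad-nonneg {k} ((_ , vals , mads , Σvals≡M) , _) =
  ℚₚ.≤-trans (ℚₚ.≤-reflexive 0≡Σ0) (ℚₚ.≤-trans (sumℚ-mono-≤ (Mad-nonneg ∘ mads)) (ℚₚ.≤-reflexive Σvals≡M))
  where
  0≡Σ0 : toℚ 0 ≡ sumℚ {k} (λ _ → toℚ 0)
  0≡Σ0 = sym (trans (sumℚ-toℚ {k} (λ _ → 0)) (cong toℚ (sumℕ-zero {k} λ _ → refl)))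

module Extremal {k n M} (maxMad : MaxMad k (suc n) M) (F : Floor M) (cert : Certificate k (suc n) (Floor.value F)) where
  open Floor F
  open Certificate cert

  floor-degeneracies : ∀ c → ∃[ d ] (∀ i → Degenerate (class c i) (d i)) × sumℕ d ≤ value
  floor-degeneracies c = d , degenerate , greatest (sumℕ d) Σd≤M
    where
    mad : ∀ i → ∃ (Mad (class c i))
    mad i = Mad-exists (class-isSimple c i) fzero
    floorᵢ : ∀ i → Floor (proj₁ (mad i))
    floorᵢ i = nonneg-floor _ (Mad-nonneg (proj₂ (mad i)))
    d : Fin k → ℕ
    d i = Floor.value (floorᵢ i)
    degenerate : ∀ i → Degenerate (class c i) (d i)
    degenerate i = Mad⇒degenerate (class-isSimple c i) (proj₂ (mad i)) (d i) (Floor.greatest (floorᵢ i))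
    Σd≤M : toℚ (sumℕ d) ℚ.≤ M
    Σd≤M = ℚₚ.≤-trans (ℚₚ.≤-reflexive (sym (sumℚ-toℚ d)))
             (ℚₚ.≤-trans (sumℚ-mono-≤ (Floor.below ∘ floorᵢ)) (proj₂ maxMad c (proj₁ ∘ mad) (proj₂ ∘ mad)))

  sum-degrees≡ : sumℕ degrees ≡ value
  sum-degrees≡ = ℕₚ.≤-antisym (ℕₚ.≤-trans (sumℕ-mono (degrees≤ (proj₁ optimum) (proj₁ (proj₂ optimum)))) (proj₂ (proj₂ optimum))) floor≤
    where
    optimum = floor-degeneracies colouring
    degrees≤ : ∀ d′ → (∀ i → Degenerate (class colouring i) (d′ i)) → ∀ i → degrees i ≤ d′ i
    degrees≤ d′ degenerate′ i =
      let (K , clique , ∣K∣≡) = proj₁ (tight i)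
      in ℕₚ.≤-pred (subst (_≤ suc (d′ i)) ∣K∣≡ (degenerate⇒clique≤ (degenerate′ i) clique))

  maxSum : (P : ∀ {n} → Adj n → ℕ → Set) →
           (∀ {a : Adj (suc n)} → IsSimple a → ∀ {d} → Degenerate a d → ∀ {x} → P a x → x ≤ d) →
           (∀ {a : Adj (suc n)} → IsSimple a → ∀ {d} → Tight a d → P a d) → MaxSumℕ P k (suc n) value
  maxSum P upper exact =
    (colouring , degrees , (λ i → exact (class-isSimple colouring i) (tight i)) , sum-degrees≡) ,
    λ c vals P-vals → let (d′ , degenerate′ , Σd′≤) = floor-degeneracies c in
      ℕₚ.≤-trans (sumℕ-mono λ i → upper (class-isSimple c i) (degenerate′ i) (P-vals i)) Σd′≤

  maxSum+k : (P : ∀ {n} → Adj n → ℕ → Set) →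
             (∀ {a : Adj (suc n)} → IsSimple a → ∀ {d} → Degenerate a d → ∀ {x} → P a x → x ≤ suc d) →
             (∀ {a : Adj (suc n)} → IsSimple a → ∀ {d} → Tight a d → P a (suc d)) → MaxSumℕ P k (suc n) (value + k)
  maxSum+k P upper exact =
    (colouring , suc ∘ degrees , (λ i → exact (class-isSimple colouring i) (tight i)) ,
     trans (sumℕ-suc degrees) (cong (_+ k) sum-degrees≡)) ,
    λ c vals P-vals → let (d′ , degenerate′ , Σd′≤) = floor-degeneracies c in
      ℕₚ.≤-trans (sumℕ-mono λ i → upper (class-isSimple c i) (degenerate′ i) (P-vals i))
                 (ℕₚ.≤-trans (ℕₚ.≤-reflexive (sumℕ-suc d′)) (ℕₚ.+-monoˡ-≤ k Σd′≤))

-- Opened only here: ℤ's prefix +_ makes sections such as (c +_) above ambiguous.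
open import Data.Integer using (+_)

theorem7p3 : ∀ (n k p q r : ℕ) → 3 ≤ n → 2 ≤ k → k ≤ n C 2 →
    k * (p C 2) ≤ n C 2 → n C 2 < k * (suc p C 2) →
    n C 2 ≡ k * (p C 2) + q * p + r → q < k → r < p →
    (M : ℚ) → MaxMad k n M →
    Type1 k n p q r M ⊎ Type2 k n p q r M →
    ∃[ f ] (+ f ≡ floor M)
      × MaxSumℕ CliqueNumber k n (f + k)
      × MaxSumℕ ChromaticNumber k n (f + k)
      × MaxSumℕ ChoiceNumber k n (f + k)
      × MaxSumℕ ColouringNumber k n (f + k)
      × MaxSumℕ KappaStar k n f
      × MaxSumℕ LambdaStar k n f
      × MaxSumℕ Degeneracy k n f
theorem7p3 zero _ _ _ _ () _ _ _ _ _ _ _ _ _ _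
theorem7p3 (suc n) k zero _ _ _ _ _ _ n₂<k·0 _ _ _ _ _ _ =
  ⊥-elim (ℕₚ.n≮0 (subst (suc n C 2 <_) (ℕₚ.*-zeroʳ k) n₂<k·0))
theorem7p3 (suc n) k (suc p) _ _ _ _ _ _ _ _ _ _ M maxMad packing =
  value , sym floor≡ ,
  maxSum+k CliqueNumber cliqueNumber≤ tight⇒cliqueNumber ,
  maxSum+k ChromaticNumber chromaticNumber≤ tight⇒chromaticNumber ,
  maxSum+k ChoiceNumber choiceNumber≤ tight⇒choiceNumber ,
  maxSum+k ColouringNumber colouringNumber≤ tight⇒colouringNumber ,
  maxSum KappaStar kappaStar≤ tight⇒kappaStar ,
  maxSum LambdaStar lambdaStar≤ tight⇒lambdaStar ,
  maxSum Degeneracy degeneracy≤ tight⇒degeneracy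
  where
  F = nonneg-floor M (MaxMad-nonneg maxMad)
  open Floor F
  open Extremal maxMad F ([ type1-certificate F , type2-certificate F ]′ packing)
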